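{- Let $n>2$ and let $S\pi$ be an embedded subset of $N$ with $\pi=\{S,S_2,\dots,S_k\}$ a $k$-partition, $s=|S|$ and $s_i=|S_i|$. Then the number of maximal chains in $(\mathfrak{C}(n)_\bot,\sqsubseteq)$ from $\bot$ to $S\pi$ is $|\mathcal{C}([\bot,S\pi])|=\frac{s(n-k)!}{2^{n-k}}s!s_2!\cdots s_k!$, and the number of maximal chains from $S\pi$ to $N\{N\}$ is $|\mathcal{C}([S\pi,N\{N\}])|=\frac{1}{k}|\mathcal{C}(\mathfrak{C}(k)_\bot)|=\frac{k!(k-1)!}{2^{k-1}}$.
   Context: Let $N=\{1,\dots,n\}$. An embedded subset is a pair $(S,\pi)$, written $S\pi$, with $S\subseteq N$ nonempty and $\pi$ a partition of $N$ having $S$ as a block. For any $m$, $\mathfrak{C}(m)_\bot$ is the set of embedded subsets of $\{1,\dots,m\}$ together with an added least element $\bot$, ordered by $(S,\pi)\sqsubseteq(S',\pi')$ iff $S\subseteq S'$ and $\pi$ refines $\pi'$; its top is $N\{N\}=(N,\{N\})$. For a bounded poset $P$ (or interval $[x,y]$), $\mathcal{C}(P)$ is the set of maximal chains from its bottom to its top. -}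

module Defs where

open import Data.Bool using (Bool; true; false)
open import Data.Nat using (ℕ; suc; _^_; _/_; _*_)
open import Data.Nat.Properties using (m^n≢0)
open import Data.Fin using (Fin)
open import Data.Fin.Subset using (Subset; _⊆_)
open import Data.Vec using (Vec; lookup; replicate)
open import Data.List using (List; []; _∷_; length)
open import Data.List.Membership.Propositional using (_∈_)
open import Data.List.Relation.Unary.All using (All)
open import Data.List.Relation.Unary.Unique.Propositional using (Unique)
open import Data.Product using (Σ; ∃; _×_)
open import Data.Sum using (_⊎_)
open import Data.Unit using (⊤)
open import Data.Empty using (⊥)
open import Relation.Binary.PropositionalEquality using (_≡_; _≢_)

-- A relation on N = Fin n, stored as a Boolean adjacency matrix
-- (so that equality of partitions is ordinary equality of data).
Rel : ℕ → Set
Rel n = Vec (Vec Bool n) n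

_∼[_]_ : ∀ {n} → Fin n → Rel n → Fin n → Set
i ∼[ R ] j = lookup (lookup R i) j ≡ true

IsPartition : ∀ {n} → Rel n → Set
IsPartition {n} R =
  (∀ (i : Fin n) → i ∼[ R ] i) ×
  (∀ (i j : Fin n) → i ∼[ R ] j → j ∼[ R ] i) ×
  (∀ (i j l : Fin n) → i ∼[ R ] j → j ∼[ R ] l → i ∼[ R ] l)

IsBlock : ∀ {n} → Rel n → Subset n → Set
IsBlock {n} R B = Σ (Fin n) λ i → B ≡ lookup R i

_refines_ : ∀ {n} → Rel n → Rel n → Set
_refines_ {n} R R' = ∀ (i j : Fin n) → i ∼[ R ] j → i ∼[ R' ] j

data Elem (n : ℕ) : Set where
  bot : Elem n
  emb : Subset n → Rel n → Elem n

Valid : ∀ {n} → Elem n → Set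
Valid bot = ⊤
Valid (emb S R) = IsPartition R × IsBlock R S

_⊑_ : ∀ {n} → Elem n → Elem n → Set
bot ⊑ y = ⊤
emb S R ⊑ bot = ⊥
emb S R ⊑ emb S' R' = S ⊆ S' × R refines R'

_⊏_ : ∀ {n} → Elem n → Elem n → Set
x ⊏ y = x ⊑ y × x ≢ y

topElem : (n : ℕ) → Elem n
topElem n = emb (replicate n true) (replicate n (replicate n true))

StrictFrom : ∀ {n} → Elem n → List (Elem n) → Elem n → Set
StrictFrom x [] y = x ≡ y
StrictFrom x (z ∷ zs) y = x ⊏ z × StrictFrom z zs y

IsMaxChain : ∀ {n} → Elem n → Elem n → List (Elem n) → Set
IsMaxChain {n} x y c =
  Σ (List (Elem n)) λ zs →
    (c ≡ x ∷ zs) × StrictFrom x zs y × All Valid c ×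
    (∀ (z : Elem n) → Valid z → x ⊑ z → z ⊑ y →
       (∀ w → w ∈ c → (z ⊑ w ⊎ w ⊑ z)) → z ∈ c)

NumMaxChains : ∀ {n} → Elem n → Elem n → ℕ → Set
NumMaxChains {n} x y m =
  Σ (List (List (Elem n))) λ L →
    Unique L × All (IsMaxChain x y) L ×
    (∀ c → IsMaxChain x y c → c ∈ L) × length L ≡ m

_/2^_ : ℕ → ℕ → ℕ
a /2^ e = _/_ a (2 ^ e) {{m^n≢0 2 e}}

-- A maximal chain of [x, Sπ] is a sequence of covering steps. An embedded subset Tσ below Sπ is
-- covered exactly by the elements obtained by merging two blocks of σ lying in one block of π
-- (T grows with them when it meets them), and ⊥ is covered by the atoms {i}{{1},…,{n}}, i ∈ S.
-- If the b-th block of π contains m_b blocks of σ, put D = Σ (m_b - 1) and P = Π m_b!. Merging in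
-- block b lowers m_b by one, so induction along the first step, with C(m_b, 2) choices in block b,
-- shows that [Tσ, Sπ] has D! P / 2^D maximal chains. For σ discrete, m_b is the size of the b-th
-- block and D = n - k; the s atoms below S then give the first formula. For π = {N} there is one
-- block with m = k, giving k! (k-1)! / 2^(k-1) chains in [Sπ, N{N}], and 𝔆(k)_⊥ has k times as many.

module Submission where

open import Defs
open import Algebra.Structures using (IsCommutativeMonoid)
open import Data.Bool using (Bool; true; false; _∨_; _∧_)
open import Data.Bool.Properties using (⇔→≡; ∨-zeroʳ) renaming (_≟_ to _≟ᵇ_)
open import Data.Empty using (⊥; ⊥-elim)
open import Data.Fin as Fin using (Fin; zero; suc)
import Data.Fin.Properties as Fin
open import Data.Fin.Subset using (Subset; _⊆_; _⊂_; ∣_∣; ∁; ⁅_⁆)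
import Data.Fin.Subset.Properties as Sub
open import Data.List using (List; []; _∷_; _++_; [_]; map; length; filter; concatMap; foldr; allFin; tabulate)
open import Data.List.Properties using (length-++; length-map; map-∘; map-++; map-cong-local; filter-≐; length-tabulate)
open import Data.List.Membership.Propositional using (_∈_; lose; find)
open import Data.List.Membership.Propositional.Properties
  using (∈-++⁺ˡ; ∈-++⁺ʳ; ∈-++⁻; ∈-map⁻; ∈-map⁺; ∈-concatMap⁺; ∈-concatMap⁻; ∈-filter⁺; ∈-filter⁻; ∈-allFin)
open import Data.List.Membership.Propositional.Properties.WithK using (unique∧set⇒bag)
open import Data.List.Relation.Binary.BagAndSetEquality using (∼bag⇒↭)
open import Data.List.Relation.Binary.Disjoint.Propositional using (Disjoint)
open import Data.List.Relation.Binary.Permutation.Propositional using (_↭_)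
import Data.List.Relation.Binary.Permutation.Propositional.Properties as ↭
open import Data.List.Relation.Unary.All as All using (All; []; _∷_)
import Data.List.Relation.Unary.All.Properties as All
open import Data.List.Relation.Unary.AllPairs as AllPairs using (AllPairs; []; _∷_)
import Data.List.Relation.Unary.AllPairs.Properties as AllPairs
open import Data.List.Relation.Unary.Any using (here; there)
open import Data.List.Relation.Unary.Unique.Propositional using (Unique)
import Data.List.Relation.Unary.Unique.Propositional.Properties as Unique
open import Data.Nat using (ℕ; zero; suc; _+_; _*_; _∸_; _^_; _!; _/_; _≤_; _<_; z≤n; s≤s)
open import Data.Nat.DivMod using (m*n/n≡m)
open import Data.Nat.ListAction using (sum; product)
open import Data.Nat.ListAction.Properties using (sum-++; product-↭)
open import Data.Nat.Properties
  using (≤-refl; ≤-trans; +-identityʳ; ≤-pred; ≤-antisym; <-≤-trans; n≮0; n<1+n; m≤n⇒m≤1+n; +-mono-≤; +-mono-<-≤; +-mono-≤-<;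
         +-comm; +-suc; *-comm; *-assoc; *-zeroʳ; *-identityʳ; *-distribˡ-+; *-distribʳ-+; *-suc;
         +-cancelʳ-≡; *-cancelˡ-≡; *-cancelʳ-≡; suc-injective; m+n∸n≡m; m∸n+n≡m; _!≢0; m^n≢0;
         +-0-isCommutativeMonoid; *-1-isCommutativeMonoid)
open import Data.Nat.Tactic.RingSolver using (solve-∀)
open import Data.Product using (Σ; ∃-syntax; _×_; _,_; proj₁; proj₂)
open import Data.Sum using (_⊎_; inj₁; inj₂)
open import Data.Unit using (tt)
open import Data.Vec using (Vec; []; _∷_; lookup; replicate; count) renaming (tabulate to tabulateᵛ)
import Data.Vec.Properties as Vec
open import Function using (_∘_; id)
open import Function.Bundles using (_⇔_; mk⇔; Equivalence)
open import Relation.Binary using (DecidableEquality; tri<; tri≈; tri>)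
open import Relation.Binary.PropositionalEquality
  using (_≡_; _≢_; refl; sym; trans; cong; cong₂; subst; module ≡-Reasoning)
open import Relation.Nullary using (¬_; Dec; yes; no; ¬?; _×-dec_; _→-dec_)

module _ {A B : Set} (g : A → List B) where

  ∈-concatMap-intro : ∀ {xs a v} → a ∈ xs → v ∈ g a → v ∈ concatMap g xs
  ∈-concatMap-intro a∈ v∈ = ∈-concatMap⁺ g (lose a∈ v∈)

  ∈-concatMap-elim : ∀ {xs v} → v ∈ concatMap g xs → ∃[ a ] a ∈ xs × v ∈ g a
  ∈-concatMap-elim v∈ = find (∈-concatMap⁻ g v∈)

  unique-concatMap : ∀ {xs} → All (Unique ∘ g) xs → AllPairs (λ a b → Disjoint (g a) (g b)) xs →
                     Unique (concatMap g xs)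
  unique-concatMap us ds = Unique.concat⁺ (All.map⁺ us) (AllPairs.map⁺ ds)

  length-concatMap : ∀ xs → length (concatMap g xs) ≡ sum (map (length ∘ g) xs)
  length-concatMap []       = refl
  length-concatMap (x ∷ xs) = trans (length-++ (g x)) (cong (length (g x) +_) (length-concatMap xs))

unique-map-injectiveOn : ∀ {A B : Set} (f : A → B) {xs} → Unique xs →
  (∀ {a b} → a ∈ xs → b ∈ xs → f a ≡ f b → a ≡ b) → Unique (map f xs)
unique-map-injectiveOn f {[]}     []       _   = []
unique-map-injectiveOn f {x ∷ xs} (x∉ ∷ u) inj =
  All.map⁺ (All.tabulate λ b∈ e → All.lookup x∉ b∈ (inj (here refl) (there b∈) e)) ∷
  unique-map-injectiveOn f u (λ a∈ b∈ → inj (there a∈) (there b∈))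

allPairs-distinct : ∀ {A : Set} {R : A → A → Set} {xs} → Unique xs →
  (∀ {a b} → a ∈ xs → b ∈ xs → a ≢ b → R a b) → AllPairs R xs
allPairs-distinct {xs = []}     []       _ = []
allPairs-distinct {xs = x ∷ xs} (x∉ ∷ u) h =
  All.tabulate (λ b∈ → h (here refl) (there b∈) (All.lookup x∉ b∈)) ∷
  allPairs-distinct u (λ a∈ b∈ → h (there a∈) (there b∈))

1≤length : ∀ {A : Set} {a : A} {xs} → a ∈ xs → 1 ≤ length xs
1≤length (here _)  = s≤s z≤n
1≤length (there _) = s≤s z≤n

2≤length : ∀ {A : Set} {a b : A} {xs} → a ∈ xs → b ∈ xs → a ≢ b → 2 ≤ length xs
2≤length (here refl) (here refl) a≢b = ⊥-elim (a≢b refl)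
2≤length (here refl) (there b∈) _   = s≤s (1≤length b∈)
2≤length (there a∈)  (here refl) _  = s≤s (1≤length a∈)
2≤length (there a∈)  (there b∈) a≢b = m≤n⇒m≤1+n (2≤length a∈ b∈ a≢b)

length≤1 : ∀ {A : Set} {xs : List A} → Unique xs → (∀ {a b} → a ∈ xs → b ∈ xs → a ≡ b) → length xs ≤ 1
length≤1 {xs = []}         _                  _ = z≤n
length≤1 {xs = _ ∷ []}     _                  _ = s≤s z≤n
length≤1 {xs = _ ∷ _ ∷ _} ((x≢y ∷ _) ∷ _) all≡ = ⊥-elim (x≢y (all≡ (here refl) (there (here refl))))

pairs : ∀ {A : Set} → List A → List (A × A)
pairs []       = []
pairs (a ∷ as) = map (a ,_) as ++ pairs as

module _ {A : Set} where

  length-pairs : (xs : List A) → 2 * length (pairs xs) + length xs ≡ length xs * length xs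
  length-pairs []       = refl
  length-pairs (a ∷ as) =
    begin
      2 * length (map (a ,_) as ++ pairs as) + suc l
    ≡⟨ cong (λ t → 2 * t + suc l) (trans (length-++ (map (a ,_) as)) (cong (_+ p) (length-map (a ,_) as))) ⟩
      2 * (l + p) + suc l
    ≡⟨ rearrange l p ⟩
      suc (l + l + (2 * p + l))
    ≡⟨ cong (λ t → suc (l + l + t)) (length-pairs as) ⟩
      suc (l + l + l * l)
    ≡⟨ square l ⟩
      suc l * suc l
    ∎
    where
    open ≡-Reasoning
    l p : ℕ
    l = length as
    p = length (pairs as)
    rearrange : ∀ l p → 2 * (l + p) + suc l ≡ suc (l + l + (2 * p + l))
    rearrange = solve-∀
    square : ∀ l → suc (l + l + l * l) ≡ suc l * suc l
    square = solve-∀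

  ∈-pairs⁻ : ∀ {a b : A} {xs} → (a , b) ∈ pairs xs → a ∈ xs × b ∈ xs
  ∈-pairs⁻ {xs = x ∷ xs} p with ∈-++⁻ (map (x ,_) xs) p
  ... | inj₁ q with ∈-map⁻ (x ,_) q
  ...   | _ , c∈ , refl = here refl , there c∈
  ∈-pairs⁻ {xs = x ∷ xs} p | inj₂ q = let a∈ , b∈ = ∈-pairs⁻ q in there a∈ , there b∈

  ∈-pairs-related : ∀ {R : A → A → Set} {a b xs} → AllPairs R xs → (a , b) ∈ pairs xs → R a b
  ∈-pairs-related {xs = x ∷ xs} (r ∷ rs) p with ∈-++⁻ (map (x ,_) xs) p
  ... | inj₁ q with ∈-map⁻ (x ,_) q
  ...   | _ , c∈ , refl = All.lookup r c∈
  ∈-pairs-related {xs = x ∷ xs} (r ∷ rs) p | inj₂ q = ∈-pairs-related rs q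

  ∈-pairs⁺ : ∀ {R : A → A → Set} {a b xs} → (∀ {u} → ¬ R u u) → (∀ {u v} → R u v → ¬ R v u) →
             AllPairs R xs → a ∈ xs → b ∈ xs → R a b → (a , b) ∈ pairs xs
  ∈-pairs⁺ irr asym (r ∷ rs) (here refl) (here refl) rab = ⊥-elim (irr rab)
  ∈-pairs⁺ {xs = x ∷ xs} irr asym (r ∷ rs) (here refl) (there b∈) rab = ∈-++⁺ˡ (∈-map⁺ (x ,_) b∈)
  ∈-pairs⁺ irr asym (r ∷ rs) (there a∈) (here refl) rab = ⊥-elim (asym rab (All.lookup r a∈))
  ∈-pairs⁺ {xs = x ∷ xs} irr asym (r ∷ rs) (there a∈) (there b∈) rab =
    ∈-++⁺ʳ (map (x ,_) xs) (∈-pairs⁺ irr asym rs a∈ b∈ rab)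

  unique-pairs : ∀ {xs : List A} → Unique xs → Unique (pairs xs)
  unique-pairs {[]}     _        = []
  unique-pairs {x ∷ xs} (x∉ ∷ u) =
    Unique.++⁺ (Unique.map⁺ (cong proj₂) u) (unique-pairs u) fresh
    where
    fresh : Disjoint (map (x ,_) xs) (pairs xs)
    fresh (p∈ , p∈′) with ∈-map⁻ (x ,_) p∈
    ... | _ , _ , refl = All.lookup x∉ (proj₁ (∈-pairs⁻ p∈′)) refl

filter-cong-on : ∀ {A : Set} {P Q : A → Set} (P? : ∀ a → Dec (P a)) (Q? : ∀ a → Dec (Q a)) {xs} →
  All (λ a → P a ⇔ Q a) xs → filter P? xs ≡ filter Q? xs
filter-cong-on P? Q? {[]}     []          = refl
filter-cong-on P? Q? {x ∷ xs} (px⇔qx ∷ h) with P? x | Q? x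
... | yes _  | yes _  = cong (x ∷_) (filter-cong-on P? Q? h)
... | no _   | no _   = filter-cong-on P? Q? h
... | yes px | no ¬qx = ⊥-elim (¬qx (Equivalence.to px⇔qx px))
... | no ¬px | yes qx = ⊥-elim (¬px (Equivalence.from px⇔qx qx))

module _ {A : Set} {P : A → Set} (P? : ∀ a → Dec (P a)) where

  length-filter-∷ : ∀ x xs → length (filter P? (x ∷ xs)) ≡ length (filter P? [ x ]) + length (filter P? xs)
  length-filter-∷ x xs with P? x
  ... | yes _ = refl
  ... | no _  = refl

  length-filter-≡1 : ∀ {b} {xs} → Unique xs → b ∈ xs → P b → (∀ {a} → a ∈ xs → P a → a ≡ b) →
                     length (filter P? xs) ≡ 1
  length-filter-≡1 {xs = xs} u b∈ pb only-b =
    ≤-antisym (length≤1 (Unique.filter⁺ P? u) all≡) (1≤length (∈-filter⁺ P? b∈ pb))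
    where
    all≡ : ∀ {a a′} → a ∈ filter P? xs → a′ ∈ filter P? xs → a ≡ a′
    all≡ a∈ a′∈ = let i , pa = ∈-filter⁻ P? a∈ ; i′ , pa′ = ∈-filter⁻ P? a′∈ in
                  trans (only-b i pa) (sym (only-b i′ pa′))

  length-filter-remove : ∀ (_≟_ : DecidableEquality A) {j xs} → Unique xs → j ∈ xs → P j →
    suc (length (filter (λ a → P? a ×-dec ¬? (a ≟ j)) xs)) ≡ length (filter P? xs)
  length-filter-remove _≟_ {j} {x ∷ xs} (x∉ ∷ u) (here refl) pj with P? x | x ≟ x
  ... | no ¬pj | _      = ⊥-elim (¬pj pj)
  ... | yes _  | no x≢x = ⊥-elim (x≢x refl)
  ... | yes _  | yes _  = cong (suc ∘ length) (filter-cong-on _ P? (All.map (λ x≢a → mk⇔ proj₁ (_, x≢a ∘ sym)) x∉))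
  length-filter-remove _≟_ {j} {x ∷ xs} (x∉ ∷ u) (there j∈) pj with P? x | x ≟ j
  ... | no _  | _        = length-filter-remove _≟_ u j∈ pj
  ... | yes _ | yes refl = ⊥-elim (All.lookup x∉ j∈ refl)
  ... | yes _ | no _     = cong suc (length-filter-remove _≟_ u j∈ pj)

sum-map-cong : ∀ {A : Set} {f g : A → ℕ} {xs} → All (λ a → f a ≡ g a) xs → sum (map f xs) ≡ sum (map g xs)
sum-map-cong = cong sum ∘ map-cong-local

product-map-cong : ∀ {A : Set} {f g : A → ℕ} {xs} → All (λ a → f a ≡ g a) xs →
                   product (map f xs) ≡ product (map g xs)
product-map-cong = cong product ∘ map-cong-local

sum-map-+ : ∀ {A : Set} (f g : A → ℕ) xs → sum (map (λ a → f a + g a) xs) ≡ sum (map f xs) + sum (map g xs)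
sum-map-+ f g []       = refl
sum-map-+ f g (x ∷ xs) = trans (cong (f x + g x +_) (sum-map-+ f g xs)) (interchange (f x) (g x) _ _)
  where
  interchange : ∀ a b c d → (a + b) + (c + d) ≡ (a + c) + (b + d)
  interchange = solve-∀

sum-map-*ʳ : ∀ {A : Set} (f : A → ℕ) K xs → sum (map (λ a → f a * K) xs) ≡ sum (map f xs) * K
sum-map-*ʳ f K []       = refl
sum-map-*ʳ f K (x ∷ xs) = trans (cong (f x * K +_) (sum-map-*ʳ f K xs)) (sym (*-distribʳ-+ K (f x) _))

*-sum-map : ∀ {A : Set} (f : A → ℕ) c xs → c * sum (map f xs) ≡ sum (map (λ a → c * f a) xs)
*-sum-map f c []       = *-zeroʳ c
*-sum-map f c (x ∷ xs) = trans (*-distribˡ-+ c (f x) _) (cong (c * f x +_) (*-sum-map f c xs))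

sum-map-const : ∀ {A : Set} {f : A → ℕ} {K} {xs} → All (λ a → f a ≡ K) xs → sum (map f xs) ≡ length xs * K
sum-map-const []         = refl
sum-map-const (fx≡K ∷ h) = cong₂ _+_ fx≡K (sum-map-const h)

product-map-ones : ∀ {A : Set} {f : A → ℕ} {xs} → All (λ a → f a ≡ 1) xs → product (map f xs) ≡ 1
product-map-ones []          = refl
product-map-ones (fx≡1 ∷ h) = cong₂ _*_ fx≡1 (product-map-ones h)

sum-map-pred : ∀ {A : Set} (f : A → ℕ) {xs} → All (λ a → 1 ≤ f a) xs →
               sum (map (λ a → f a ∸ 1) xs) + length xs ≡ sum (map f xs)
sum-map-pred f {[]}     []       = refl
sum-map-pred f {x ∷ xs} (1≤fx ∷ h) =
  trans (rearrange (f x ∸ 1) (sum (map (λ a → f a ∸ 1) xs)) (length xs))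
        (cong₂ _+_ (m∸n+n≡m 1≤fx) (sum-map-pred f h))
  where
  rearrange : ∀ a b c → a + b + suc c ≡ (a + 1) + (b + c)
  rearrange = solve-∀

sum-count-swap : ∀ {A B : Set} {R : A → B → Set} (R? : ∀ a b → Dec (R a b)) (K : List A) (L : List B) →
  sum (map (λ b → length (filter (λ k → R? k b) K)) L) ≡ sum (map (λ k → length (filter (R? k) L)) K)
sum-count-swap R? []      L = sum-zero L
  where
  sum-zero : ∀ L → sum (map (λ _ → 0) L) ≡ 0
  sum-zero []      = refl
  sum-zero (_ ∷ L) = sum-zero L
sum-count-swap R? (k ∷ K) L =
  begin
    sum (map (λ b → length (filter (λ k′ → R? k′ b) (k ∷ K))) L)
  ≡⟨ sum-map-cong (All.tabulate {xs = L} λ {b} _ → length-filter-∷ (λ k′ → R? k′ b) k K) ⟩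
    sum (map (λ b → length (filter (λ k′ → R? k′ b) [ k ]) + length (filter (λ k′ → R? k′ b) K)) L)
  ≡⟨ sum-map-+ _ _ L ⟩
    sum (map (λ b → length (filter (λ k′ → R? k′ b) [ k ])) L) + sum (map (λ b → length (filter (λ k′ → R? k′ b) K)) L)
  ≡⟨ cong₂ _+_ (row L) (sum-count-swap R? K L) ⟩
    length (filter (R? k) L) + sum (map (λ k′ → length (filter (R? k′) L)) K)
  ∎
  where
  open ≡-Reasoning
  row : ∀ L → sum (map (λ b → length (filter (λ k′ → R? k′ b) [ k ])) L) ≡ length (filter (R? k) L)
  row []      = refl
  row (b ∷ L) with R? k b
  ... | yes _ = cong suc (row L)
  ... | no _  = row L

module _ {M : Set} {_∙_ : M → M → M} {ε : M} (isCM : IsCommutativeMonoid _≡_ _∙_ ε) where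

  open IsCommutativeMonoid isCM using (assoc; comm)

  foldr-map-update : ∀ {A : Set} (f g : A → M) {b xs} → Unique xs → b ∈ xs →
    All (λ a → a ≢ b → f a ≡ g a) xs → foldr _∙_ ε (map f xs) ∙ g b ≡ foldr _∙_ ε (map g xs) ∙ f b
  foldr-map-update f g {b} {x ∷ xs} (x∉ ∷ u) (here refl) (_ ∷ h) =
    begin
      (f b ∙ F) ∙ g b  ≡⟨ comm _ (g b) ⟩
      g b ∙ (f b ∙ F)  ≡⟨ cong (g b ∙_) (comm (f b) F) ⟩
      g b ∙ (F ∙ f b)  ≡⟨ assoc (g b) F (f b) ⟨
      (g b ∙ F) ∙ f b  ≡⟨ cong (λ t → (g b ∙ t) ∙ f b) F≡G ⟩
      (g b ∙ G) ∙ f b  ∎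
    where
    open ≡-Reasoning
    F G : M
    F = foldr _∙_ ε (map f xs)
    G = foldr _∙_ ε (map g xs)
    F≡G : F ≡ G
    F≡G = cong (foldr _∙_ ε) (map-cong-local (All.zipWith (λ (b≢a , fa≡ga) → fa≡ga (b≢a ∘ sym)) (x∉ , h)))
  foldr-map-update f g {b} {x ∷ xs} (x∉ ∷ u) (there b∈) (fx≡gx ∷ h) =
    begin
      (f x ∙ F) ∙ g b  ≡⟨ assoc (f x) F (g b) ⟩
      f x ∙ (F ∙ g b)  ≡⟨ cong₂ _∙_ (fx≡gx λ { refl → All.lookup x∉ b∈ refl }) (foldr-map-update f g u b∈ h) ⟩
      g x ∙ (G ∙ f b)  ≡⟨ assoc (g x) G (f b) ⟨
      (g x ∙ G) ∙ f b  ∎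
    where
    open ≡-Reasoning
    F G : M
    F = foldr _∙_ ε (map f xs)
    G = foldr _∙_ ε (map g xs)

sum-map-update : ∀ {A : Set} (f g : A → ℕ) {b xs} → Unique xs → b ∈ xs →
  All (λ a → a ≢ b → f a ≡ g a) xs → sum (map f xs) + g b ≡ sum (map g xs) + f b
sum-map-update = foldr-map-update +-0-isCommutativeMonoid

product-map-update : ∀ {A : Set} (f g : A → ℕ) {b xs} → Unique xs → b ∈ xs →
  All (λ a → a ≢ b → f a ≡ g a) xs → product (map f xs) * g b ≡ product (map g xs) * f b
product-map-update = foldr-map-update *-1-isCommutativeMonoid

sum-map-concatMap : ∀ {A B : Set} (g : B → ℕ) (h : A → List B) xs →
                    sum (map g (concatMap h xs)) ≡ sum (map (λ a → sum (map g (h a))) xs)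
sum-map-concatMap g h []       = refl
sum-map-concatMap g h (x ∷ xs) =
  trans (cong sum (map-++ g (h x) (concatMap h xs)))
        (trans (sum-++ (map g (h x)) _) (cong (sum (map g (h x)) +_) (sum-map-concatMap g h xs)))

-- Each of the m (m - 1) / 2 pairs contributes K / m.
sum-pairs-uniform : ∀ {A : Set} (L : List A) (c : A × A → ℕ) u K →
  All (λ p → length L * (u * c p) ≡ K) (pairs L) → 2 * (u * sum (map c (pairs L))) ≡ (length L ∸ 1) * K
sum-pairs-uniform []      c u K _     = cong (2 *_) (*-zeroʳ u)
sum-pairs-uniform (a ∷ L) c u K terms =
  *-cancelˡ-≡ _ _ m (begin
    m * (2 * X)        ≡⟨ swap m 2 X ⟩
    2 * (m * X)        ≡⟨ cong (2 *_) m*X≡ ⟩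
    2 * (np * K)       ≡⟨ *-assoc 2 np K ⟨
    2 * np * K         ≡⟨ cong (_* K) 2np≡ ⟩
    m * length L * K   ≡⟨ *-assoc m (length L) K ⟩
    m * (length L * K) ∎)
  where
  open ≡-Reasoning
  m X np : ℕ
  m  = suc (length L)
  X  = u * sum (map c (pairs (a ∷ L)))
  np = length (pairs (a ∷ L))
  swap : ∀ a b c → a * (b * c) ≡ b * (a * c)
  swap = solve-∀
  m*X≡ : m * X ≡ np * K
  m*X≡ = trans (cong (m *_) (*-sum-map c u (pairs (a ∷ L))))
               (trans (*-sum-map (λ p → u * c p) m (pairs (a ∷ L))) (sum-map-const terms))
  2np≡ : 2 * np ≡ m * length L
  2np≡ = +-cancelʳ-≡ m _ _ (trans (length-pairs (a ∷ L)) (trans (*-suc m (length L)) (+-comm m _)))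

-- The order and its maximal chains

Vec-ext : ∀ {A : Set} {n} (u v : Vec A n) → (∀ i → lookup u i ≡ lookup v i) → u ≡ v
Vec-ext u v h = trans (sym (Vec.tabulate∘lookup u)) (trans (Vec.tabulate-cong h) (Vec.tabulate∘lookup v))

Bool-ext : ∀ {a b : Bool} → (a ≡ true → b ≡ true) → (b ≡ true → a ≡ true) → a ≡ b
Bool-ext a⇒b b⇒a = ⇔→≡ (mk⇔ a⇒b b⇒a)

refines-antisym : ∀ {n} (R R′ : Rel n) → R refines R′ → R′ refines R → R ≡ R′
refines-antisym R R′ R⊑R′ R′⊑R =
  Vec-ext R R′ λ i → Vec-ext (lookup R i) (lookup R′ i) λ j → Bool-ext (R⊑R′ i j) (R′⊑R i j)

_≟ᴱ_ : ∀ {n} → DecidableEquality (Elem n)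
bot      ≟ᴱ bot        = yes refl
bot      ≟ᴱ emb _ _    = no λ ()
emb _ _  ≟ᴱ bot        = no λ ()
emb S R  ≟ᴱ emb S′ R′ with Vec.≡-dec _≟ᵇ_ S S′ | Vec.≡-dec (Vec.≡-dec _≟ᵇ_) R R′
... | yes refl | yes refl = yes refl
... | no S≢S′  | _        = no λ { refl → S≢S′ refl }
... | yes _    | no R≢R′  = no λ { refl → R≢R′ refl }

⊑-refl : ∀ {n} (x : Elem n) → x ⊑ x
⊑-refl bot       = tt
⊑-refl (emb S R) = Sub.⊆-refl , λ _ _ → id

⊑-trans : ∀ {n} {x y z : Elem n} → x ⊑ y → y ⊑ z → x ⊑ z
⊑-trans {x = bot} _ _ = tt
⊑-trans {x = emb _ _} {emb _ _} {emb _ _} (S⊆S′ , R⊑R′) (S′⊆S″ , R′⊑R″) =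
  Sub.⊆-trans S⊆S′ S′⊆S″ , λ i j → R′⊑R″ i j ∘ R⊑R′ i j

⊑-antisym : ∀ {n} {x y : Elem n} → x ⊑ y → y ⊑ x → x ≡ y
⊑-antisym {x = bot}     {bot}      _ _ = refl
⊑-antisym {x = bot}     {emb _ _}  _ ()
⊑-antisym {x = emb _ _} {emb _ _} (S⊆S′ , R⊑R′) (S′⊆S , R′⊑R) =
  cong₂ emb (Sub.⊆-antisym S⊆S′ S′⊆S) (refines-antisym _ _ R⊑R′ R′⊑R)

StrictFrom⇒⊑ : ∀ {n} {x y : Elem n} zs → StrictFrom x zs y → x ⊑ y
StrictFrom⇒⊑ {x = x} []       refl               = ⊑-refl x
StrictFrom⇒⊑         (z ∷ zs) ((x⊑z , _) , z⋯y) = ⊑-trans x⊑z (StrictFrom⇒⊑ zs z⋯y)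

StrictFrom⇒⊑-∈ : ∀ {n} {x y u : Elem n} zs → StrictFrom x zs y → u ∈ zs → x ⊑ u
StrictFrom⇒⊑-∈ (z ∷ zs) ((x⊑z , _) , z⋯y) (here refl) = x⊑z
StrictFrom⇒⊑-∈ (z ∷ zs) ((x⊑z , _) , z⋯y) (there u∈) = ⊑-trans x⊑z (StrictFrom⇒⊑-∈ zs z⋯y u∈)

module MaximalChains {n} (y : Elem n) where

  _⋖_ : Elem n → Elem n → Set
  x ⋖ z = Valid z × x ⊏ z × z ⊑ y × (∀ w → Valid w → x ⊑ w → w ⊑ z → w ≡ x ⊎ w ≡ z)

  record CoverListing : Set where
    field
      covers          : Elem n → List (Elem n)
      rank            : Elem n → ℕ
      covers-unique   : ∀ x → Valid x → x ⊑ y → Unique (covers x)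
      covers-sound    : ∀ x → Valid x → x ⊑ y → ∀ {z} → z ∈ covers x → x ⋖ z
      covers-complete : ∀ x → Valid x → x ⊑ y → ∀ {z} → x ⋖ z → z ∈ covers x
      rank-covers     : ∀ x → Valid x → x ⊑ y → ∀ {z} → z ∈ covers x → rank z < rank x

  module Enumeration (L : CoverListing) where

    open CoverListing L

    -- f is fuel bounding the length of the chains; rank x suffices.
    chains : ℕ → Elem n → List (List (Elem n))
    chains f x with x ≟ᴱ y
    ... | yes _ = [ [ x ] ]
    chains zero    x | no _ = []
    chains (suc f) x | no _ = concatMap (λ z → map (x ∷_) (chains f z)) (covers x)

    chainCount : ℕ → Elem n → ℕ
    chainCount f x = length (chains f x)

    chainCount-top : ∀ f → chainCount f y ≡ 1
    chainCount-top f with y ≟ᴱ y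
    ... | yes _   = refl
    ... | no y≢y  = ⊥-elim (y≢y refl)

    chainCount-step : ∀ f x → x ≢ y → chainCount (suc f) x ≡ sum (map (chainCount f) (covers x))
    chainCount-step f x x≢y with x ≟ᴱ y
    ... | yes x≡y = ⊥-elim (x≢y x≡y)
    ... | no _    =
      trans (length-concatMap (λ z → map (x ∷_) (chains f z)) (covers x))
            (sum-map-cong {xs = covers x} (All.tabulate λ {z} _ → length-map (x ∷_) (chains f z)))

    chains-head : ∀ f x {c} → c ∈ chains f x → ∃[ cs ] c ≡ x ∷ cs
    chains-head f x c∈ with x ≟ᴱ y
    chains-head f       x (here refl) | yes _ = [] , refl
    chains-head (suc f) x c∈          | no _ with ∈-concatMap-elim (λ z → map (x ∷_) (chains f z)) {covers x} c∈
    ... | z , _ , c∈′ with ∈-map⁻ (x ∷_) c∈′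
    ...   | cs , _ , refl = cs , refl

    chains-unique : ∀ f x → Valid x → x ⊑ y → Unique (chains f x)
    chains-unique f x vx x⊑y with x ≟ᴱ y
    ... | yes _ = [] ∷ []
    chains-unique zero    x vx x⊑y | no _ = []
    chains-unique (suc f) x vx x⊑y | no _ =
      unique-concatMap _
        (All.tabulate λ {z} z∈ → let vz , _ , z⊑y , _ = covers-sound x vx x⊑y z∈ in
                                 Unique.map⁺ (λ { refl → refl }) (chains-unique f z vz z⊑y))
        (AllPairs.map disjoint (covers-unique x vx x⊑y))
      where
      disjoint : ∀ {a b} → a ≢ b → Disjoint (map (x ∷_) (chains f a)) (map (x ∷_) (chains f b))
      disjoint {a} {b} a≢b (c∈a , c∈b) with ∈-map⁻ (x ∷_) c∈a | ∈-map⁻ (x ∷_) c∈b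
      ... | ca , ca∈ , refl | cb , cb∈ , eq with chains-head f a ca∈ | chains-head f b cb∈
      ...   | _ , refl | _ , refl = a≢b (cong (λ { (_ ∷ u ∷ _) → u ; _ → a }) eq)

    chains-sound : ∀ f x → Valid x → x ⊑ y → ∀ {c} → c ∈ chains f x → IsMaxChain x y c
    chains-sound f x vx x⊑y c∈ with x ≟ᴱ y
    chains-sound f x vx x⊑y (here refl) | yes refl =
      [] , refl , refl , vx ∷ [] , λ z _ x⊑z z⊑x _ → here (⊑-antisym z⊑x x⊑z)
    chains-sound (suc f) x vx x⊑y c∈ | no _ with ∈-concatMap-elim (λ z → map (x ∷_) (chains f z)) {covers x} c∈
    ... | z , z∈ , c∈′ with ∈-map⁻ (x ∷_) c∈′ | covers-sound x vx x⊑y z∈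
    ...   | c′ , c′∈ , refl | vz , x⊏z , z⊑y , x⋖z with chains-sound f z vz z⊑y c′∈
    ...     | zs , refl , z⋯y , valid , maximal =
      z ∷ zs , refl , (x⊏z , z⋯y) , vx ∷ valid , maximal′
      where
      maximal′ : ∀ w → Valid w → x ⊑ w → w ⊑ y → (∀ u → u ∈ x ∷ z ∷ zs → w ⊑ u ⊎ u ⊑ w) → w ∈ x ∷ z ∷ zs
      maximal′ w vw x⊑w w⊑y comparable with comparable z (there (here refl))
      ... | inj₂ z⊑w = there (maximal w vw z⊑w w⊑y (λ u → comparable u ∘ there))
      ... | inj₁ w⊑z with x⋖z w vw x⊑w w⊑z
      ...   | inj₁ refl = here refl
      ...   | inj₂ refl = there (here refl)

    module _ {x z zs} (vz : Valid z) (x⊏z : x ⊏ z) (z⋯y : StrictFrom z zs y)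
             (maximal : ∀ w → Valid w → x ⊑ w → w ⊑ y → (∀ u → u ∈ x ∷ z ∷ zs → w ⊑ u ⊎ u ⊑ w) → w ∈ x ∷ z ∷ zs)
             where

      maxChain-first-cover : x ⋖ z
      maxChain-first-cover = vz , x⊏z , StrictFrom⇒⊑ zs z⋯y , between
        where
        between : ∀ w → Valid w → x ⊑ w → w ⊑ z → w ≡ x ⊎ w ≡ z
        between w vw x⊑w w⊑z with maximal w vw x⊑w (⊑-trans w⊑z (StrictFrom⇒⊑ zs z⋯y)) comparable
          where
          comparable : ∀ u → u ∈ x ∷ z ∷ zs → w ⊑ u ⊎ u ⊑ w
          comparable u (here refl)         = inj₂ x⊑w
          comparable u (there (here refl)) = inj₁ w⊑z
          comparable u (there (there u∈))  = inj₁ (⊑-trans w⊑z (StrictFrom⇒⊑-∈ zs z⋯y u∈))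
        ... | here refl         = inj₁ refl
        ... | there (here refl) = inj₂ refl
        ... | there (there w∈)  = inj₂ (⊑-antisym w⊑z (StrictFrom⇒⊑-∈ zs z⋯y w∈))

      maxChain-tail : All Valid (z ∷ zs) → IsMaxChain z y (z ∷ zs)
      maxChain-tail valid = zs , refl , z⋯y , valid , maximal′
        where
        maximal′ : ∀ w → Valid w → z ⊑ w → w ⊑ y → (∀ u → u ∈ z ∷ zs → w ⊑ u ⊎ u ⊑ w) → w ∈ z ∷ zs
        maximal′ w vw z⊑w w⊑y comparable
          with maximal w vw (⊑-trans (proj₁ x⊏z) z⊑w) w⊑y
                 (λ { u (here refl) → inj₂ (⊑-trans (proj₁ x⊏z) z⊑w) ; u (there u∈) → comparable u u∈ })
        ... | here refl = ⊥-elim (proj₂ x⊏z (⊑-antisym (proj₁ x⊏z) z⊑w))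
        ... | there w∈  = w∈

    chains-complete : ∀ f x → Valid x → x ⊑ y → rank x ≤ f → ∀ {c} → IsMaxChain x y c → c ∈ chains f x
    chains-complete f x vx x⊑y rank≤f maxChain with x ≟ᴱ y
    chains-complete f x vx x⊑y rank≤f ([] , refl , _ , _) | yes refl = here refl
    chains-complete f x vx x⊑y rank≤f (z ∷ zs , refl , ((x⊑z , x≢z) , z⋯y) , _) | yes refl =
      ⊥-elim (x≢z (⊑-antisym x⊑z (StrictFrom⇒⊑ zs z⋯y)))
    chains-complete f x vx x⊑y rank≤f ([] , refl , refl , _) | no x≢y = ⊥-elim (x≢y refl)
    chains-complete zero x vx x⊑y rank≤0 (z ∷ zs , refl , (x⊏z , z⋯y) , _ ∷ vz ∷ _ , maximal) | no _ =
      ⊥-elim (n≮0 (<-≤-trans (rank-covers x vx x⊑y z∈) rank≤0))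
      where
      z∈ : z ∈ covers x
      z∈ = covers-complete x vx x⊑y (maxChain-first-cover vz x⊏z z⋯y maximal)
    chains-complete (suc f) x vx x⊑y rank≤f (z ∷ zs , refl , (x⊏z , z⋯y) , _ ∷ valid@(vz ∷ _) , maximal) | no _ =
      ∈-concatMap-intro (λ u → map (x ∷_) (chains f u)) z∈
        (∈-map⁺ (x ∷_) (chains-complete f z vz (StrictFrom⇒⊑ zs z⋯y) (≤-pred (≤-trans (rank-covers x vx x⊑y z∈) rank≤f))
                                        (maxChain-tail vz x⊏z z⋯y maximal valid)))
      where
      z∈ : z ∈ covers x
      z∈ = covers-complete x vx x⊑y (maxChain-first-cover vz x⊏z z⋯y maximal)

    numMaxChains : ∀ f x → Valid x → x ⊑ y → rank x ≤ f → NumMaxChains x y (chainCount f x)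
    numMaxChains f x vx x⊑y rank≤f =
      chains f x , chains-unique f x vx x⊑y , All.tabulate (chains-sound f x vx x⊑y) ,
      (λ c → chains-complete f x vx x⊑y rank≤f) , refl

-- Partitions and the merging of blocks

∨-true⁻ : ∀ {a b} → a ∨ b ≡ true → a ≡ true ⊎ b ≡ true
∨-true⁻ {true}  _ = inj₁ refl
∨-true⁻ {false} p = inj₂ p

∨-trueˡ : ∀ {a} b → a ≡ true → a ∨ b ≡ true
∨-trueˡ b refl = refl

∨-trueʳ : ∀ a {b} → b ≡ true → a ∨ b ≡ true
∨-trueʳ a refl = ∨-zeroʳ a

∧-true⁻ : ∀ {a b} → a ∧ b ≡ true → a ≡ true × b ≡ true
∧-true⁻ {true} {true} _ = refl , refl

∧-true⁺ : ∀ {a b} → a ≡ true → b ≡ true → a ∧ b ≡ true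
∧-true⁺ refl refl = refl

rel : ∀ {n} → Rel n → Fin n → Fin n → Bool
rel R i j = lookup (lookup R i) j

_∼[_]?_ : ∀ {n} (i : Fin n) (R : Rel n) (j : Fin n) → Dec (i ∼[ R ] j)
i ∼[ R ]? j = rel R i j ≟ᵇ true

_∈ₛ_ : ∀ {n} → Fin n → Subset n → Set
k ∈ₛ T = lookup T k ≡ true

⊆⇒∈ₛ : ∀ {n} {T T′ : Subset n} → T ⊆ T′ → ∀ {k} → k ∈ₛ T → k ∈ₛ T′
⊆⇒∈ₛ {T = T} T⊆T′ {k} k∈T = Vec.[]=⇒lookup (T⊆T′ (Vec.lookup⇒[]= k T k∈T))

∈ₛ⇒⊆ : ∀ {n} {T T′ : Subset n} → (∀ k → k ∈ₛ T → k ∈ₛ T′) → T ⊆ T′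
∈ₛ⇒⊆ {T′ = T′} h {k} k∈T = Vec.lookup⇒[]= k T′ (h k (Vec.[]=⇒lookup k∈T))

members : ∀ {n} → Subset n → List (Fin n)
members {n} T = filter (λ k → lookup T k ≟ᵇ true) (allFin n)

length-filter-tabulate : ∀ {A B : Set} {P : B → Set} (P? : ∀ b → Dec (P b)) (f : A → B) {n} (h : Fin n → A) →
  length (filter (P? ∘ f) (tabulate h)) ≡ count P? (tabulateᵛ (f ∘ h))
length-filter-tabulate P? f {zero}  h = refl
length-filter-tabulate P? f {suc n} h with P? (f (h zero))
... | yes _ = cong suc (length-filter-tabulate P? f (h ∘ suc))
... | no _  = length-filter-tabulate P? f (h ∘ suc)

length-members : ∀ {n} (T : Subset n) → length (members T) ≡ ∣ T ∣
length-members T =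
  trans (length-filter-tabulate (_≟ᵇ true) (lookup T) id) (cong (count (_≟ᵇ true)) (Vec.tabulate∘lookup T))

module Partition {n} (R : Rel n) (isP : IsPartition R) where

  ∼-refl : ∀ i → i ∼[ R ] i
  ∼-refl = proj₁ isP

  ∼-sym : ∀ {i j} → i ∼[ R ] j → j ∼[ R ] i
  ∼-sym {i} {j} = proj₁ (proj₂ isP) i j

  ∼-trans : ∀ {i j l} → i ∼[ R ] j → j ∼[ R ] l → i ∼[ R ] l
  ∼-trans {i} {j} {l} = proj₂ (proj₂ isP) i j l

  block-≡ : ∀ {a b} → a ∼[ R ] b → lookup R a ≡ lookup R b
  block-≡ a∼b = Vec-ext _ _ λ k → Bool-ext (∼-trans (∼-sym a∼b)) (∼-trans a∼b)

-- Blocks are named by their least elements.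
IsRep : ∀ {n} → Rel n → Fin n → Set
IsRep R i = ∀ k → k Fin.< i → ¬ (k ∼[ R ] i)

isRep? : ∀ {n} (R : Rel n) i → Dec (IsRep R i)
isRep? R i = Fin.all? λ k → k Fin.<? i →-dec ¬? (k ∼[ R ]? i)

least : ∀ {n} {P : Fin n → Set} → (∀ k → Dec (P k)) → ∀ i → P i → ∃[ m ] P m × (∀ k → k Fin.< m → ¬ P k)
least {n} {P} P? i pi = descend (Fin.toℕ i) i ≤-refl pi
  where
  descend : ∀ b i → Fin.toℕ i ≤ b → P i → ∃[ m ] P m × (∀ k → k Fin.< m → ¬ P k)
  descend b i i≤b pi with Fin.any? (λ k → k Fin.<? i ×-dec P? k)
  ... | no ∄ = i , pi , λ k k<i pk → ∄ (k , k<i , pk)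
  descend zero    i i≤0 pi | yes (k , k<i , pk) = ⊥-elim (n≮0 (<-≤-trans k<i i≤0))
  descend (suc b) i i≤b pi | yes (k , k<i , pk) = descend b k (≤-pred (<-≤-trans k<i i≤b)) pk

module Representatives {n} (R : Rel n) (isP : IsPartition R) where

  open Partition R isP

  rep : ∀ i → ∃[ r ] r ∼[ R ] i × IsRep R r
  rep i with least (_∼[ R ]? i) i (∼-refl i)
  ... | m , m∼i , below = m , m∼i , λ k k<m k∼m → below k k<m (∼-trans k∼m m∼i)

  rep-unique : ∀ {a b} → IsRep R a → IsRep R b → a ∼[ R ] b → a ≡ b
  rep-unique {a} {b} rep-a rep-b a∼b with Fin.<-cmp a b
  ... | tri< a<b _ _ = ⊥-elim (rep-b a a<b a∼b)
  ... | tri≈ _ a≡b _ = a≡b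
  ... | tri> _ _ b<a = ⊥-elim (rep-a b b<a (∼-sym a∼b))

blockReps : ∀ {n} → Rel n → List (Fin n)
blockReps {n} R = filter (isRep? R) (allFin n)

unique-blockReps : ∀ {n} (R : Rel n) → Unique (blockReps R)
unique-blockReps {n} R = Unique.filter⁺ (isRep? R) (Unique.allFin⁺ n)

∈-blockReps⁻ : ∀ {n} (R : Rel n) {b} → b ∈ blockReps R → IsRep R b
∈-blockReps⁻ {n} R b∈ = proj₂ (∈-filter⁻ (isRep? R) {xs = allFin n} b∈)

∈-blockReps⁺ : ∀ {n} (R : Rel n) {b} → IsRep R b → b ∈ blockReps R
∈-blockReps⁺ R {b} = ∈-filter⁺ (isRep? R) (∈-allFin b)

module _ {n} (R : Rel n) (isP : IsPartition R) {B₀ bs} (u : Unique (B₀ ∷ bs))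
         (blocks : ∀ B → (B ∈ B₀ ∷ bs) ⇔ IsBlock R B) where

  open Partition R isP
  open Representatives R isP

  blocks-↭ : map (lookup R) (blockReps R) ↭ B₀ ∷ bs
  blocks-↭ = ∼bag⇒↭ (unique∧set⇒bag unique-blocks u λ {B} → mk⇔ (to B) (from B))
    where
    unique-blocks : Unique (map (lookup R) (blockReps R))
    unique-blocks = unique-map-injectiveOn (lookup R) (unique-blockReps R) λ {a} {b} a∈ b∈ Ra≡Rb →
      rep-unique (∈-blockReps⁻ R a∈) (∈-blockReps⁻ R b∈) (subst (b ∈ₛ_) (sym Ra≡Rb) (∼-refl b))
    to : ∀ B → B ∈ map (lookup R) (blockReps R) → B ∈ B₀ ∷ bs
    to B B∈ with ∈-map⁻ (lookup R) B∈
    ... | b , _ , refl = Equivalence.from (blocks B) (b , refl)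
    from : ∀ B → B ∈ B₀ ∷ bs → B ∈ map (lookup R) (blockReps R)
    from B B∈ with Equivalence.to (blocks B) B∈
    ... | i , refl with rep i
    ...   | r , r∼i , rep-r = subst (_∈ map (lookup R) (blockReps R)) (block-≡ r∼i) (∈-map⁺ (lookup R) (∈-blockReps⁺ R rep-r))

  length-blockReps : length (blockReps R) ≡ suc (length bs)
  length-blockReps = trans (sym (length-map (lookup R) (blockReps R))) (↭.↭-length blocks-↭)

  product-blockReps : ∀ (g : Subset n → ℕ) → product (map (g ∘ lookup R) (blockReps R)) ≡ product (map g (B₀ ∷ bs))
  product-blockReps g = trans (cong product (map-∘ (blockReps R))) (product-↭ (↭.map⁺ g blocks-↭))

merge : ∀ {n} → Rel n → Fin n → Fin n → Rel n
merge σ i j = tabulateᵛ λ k → tabulateᵛ λ l → rel σ k l ∨ ((rel σ i k ∧ rel σ j l) ∨ (rel σ j k ∧ rel σ i l))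

-- T together with the blocks of i and j when it meets one of them (so blocks go to blocks).
mergeSubset : ∀ {n} → Rel n → Fin n → Fin n → Subset n → Subset n
mergeSubset σ i j T = tabulateᵛ λ l → lookup T l ∨ ((lookup T i ∨ lookup T j) ∧ (rel σ i l ∨ rel σ j l))

mergeElem : ∀ {n} → Subset n → Rel n → Fin n × Fin n → Elem n
mergeElem T σ (i , j) = emb (mergeSubset σ i j T) (merge σ i j)

module Merge {n} (σ : Rel n) (i j : Fin n) where

  σ′ : Rel n
  σ′ = merge σ i j

  JoinedBy : Fin n → Fin n → Set
  JoinedBy k l = k ∼[ σ ] l ⊎ ((i ∼[ σ ] k × j ∼[ σ ] l) ⊎ (j ∼[ σ ] k × i ∼[ σ ] l))

  rel-merge : ∀ k l → rel σ′ k l ≡ (rel σ k l ∨ ((rel σ i k ∧ rel σ j l) ∨ (rel σ j k ∧ rel σ i l)))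
  rel-merge k l = trans (cong (λ v → lookup v l) (Vec.lookup∘tabulate _ k)) (Vec.lookup∘tabulate _ l)

  merge⁻ : ∀ {k l} → k ∼[ σ′ ] l → JoinedBy k l
  merge⁻ {k} {l} k∼l with ∨-true⁻ (trans (sym (rel-merge k l)) k∼l)
  ... | inj₁ p = inj₁ p
  ... | inj₂ p with ∨-true⁻ p
  ...   | inj₁ q = inj₂ (inj₁ (∧-true⁻ q))
  ...   | inj₂ q = inj₂ (inj₂ (∧-true⁻ q))

  merge-⊒ : ∀ {k l} → k ∼[ σ ] l → k ∼[ σ′ ] l
  merge-⊒ {k} {l} p = trans (rel-merge k l) (∨-trueˡ _ p)

  merge-joins : ∀ {k l} → i ∼[ σ ] k → j ∼[ σ ] l → k ∼[ σ′ ] l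
  merge-joins {k} {l} p q = trans (rel-merge k l) (∨-trueʳ (rel σ k l) (∨-trueˡ _ (∧-true⁺ p q)))

  merge-joins′ : ∀ {k l} → j ∼[ σ ] k → i ∼[ σ ] l → k ∼[ σ′ ] l
  merge-joins′ {k} {l} p q =
    trans (rel-merge k l) (∨-trueʳ (rel σ k l) (∨-trueʳ (rel σ i k ∧ rel σ j l) (∧-true⁺ p q)))

  lookup-mergeSubset : ∀ T l →
    lookup (mergeSubset σ i j T) l ≡ (lookup T l ∨ ((lookup T i ∨ lookup T j) ∧ (rel σ i l ∨ rel σ j l)))
  lookup-mergeSubset T l = Vec.lookup∘tabulate _ l

  mergeSubset-⊇ : ∀ T {l} → l ∈ₛ T → l ∈ₛ mergeSubset σ i j T
  mergeSubset-⊇ T {l} p = trans (lookup-mergeSubset T l) (∨-trueˡ _ p)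

  module _ (isPσ : IsPartition σ) where

    open Partition σ isPσ

    merge-isPartition : IsPartition σ′
    merge-isPartition = (λ k → merge-⊒ (∼-refl k)) , (λ k l → symmetric ∘ merge⁻) ,
                        (λ k l m p q → transitive (merge⁻ p) (merge⁻ q))
      where
      symmetric : ∀ {k l} → JoinedBy k l → l ∼[ σ′ ] k
      symmetric (inj₁ k∼l)                = merge-⊒ (∼-sym k∼l)
      symmetric (inj₂ (inj₁ (i∼k , j∼l))) = merge-joins′ j∼l i∼k
      symmetric (inj₂ (inj₂ (j∼k , i∼l))) = merge-joins i∼l j∼k
      transitive : ∀ {k l m} → JoinedBy k l → JoinedBy l m → k ∼[ σ′ ] m
      transitive (inj₁ k∼l)                (inj₁ l∼m)                = merge-⊒ (∼-trans k∼l l∼m)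
      transitive (inj₁ k∼l)                (inj₂ (inj₁ (i∼l , j∼m))) = merge-joins (∼-trans i∼l (∼-sym k∼l)) j∼m
      transitive (inj₁ k∼l)                (inj₂ (inj₂ (j∼l , i∼m))) = merge-joins′ (∼-trans j∼l (∼-sym k∼l)) i∼m
      transitive (inj₂ (inj₁ (i∼k , j∼l))) (inj₁ l∼m)                = merge-joins i∼k (∼-trans j∼l l∼m)
      transitive (inj₂ (inj₁ (i∼k , _)))   (inj₂ (inj₁ (_ , j∼m)))   = merge-joins i∼k j∼m
      transitive (inj₂ (inj₁ (i∼k , _)))   (inj₂ (inj₂ (_ , i∼m)))   = merge-⊒ (∼-trans (∼-sym i∼k) i∼m)
      transitive (inj₂ (inj₂ (j∼k , i∼l))) (inj₁ l∼m)                = merge-joins′ j∼k (∼-trans i∼l l∼m)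
      transitive (inj₂ (inj₂ (j∼k , _)))   (inj₂ (inj₁ (_ , j∼m)))   = merge-⊒ (∼-trans (∼-sym j∼k) j∼m)
      transitive (inj₂ (inj₂ (j∼k , _)))   (inj₂ (inj₂ (_ , i∼m)))   = merge-joins′ j∼k i∼m

    mergeSubset-block : ∀ t → mergeSubset σ i j (lookup σ t) ≡ lookup σ′ t
    mergeSubset-block t = Vec-ext _ _ λ l → Bool-ext (to l) (from l)
      where
      to : ∀ l → l ∈ₛ mergeSubset σ i j (lookup σ t) → t ∼[ σ′ ] l
      to l p with ∨-true⁻ (trans (sym (lookup-mergeSubset (lookup σ t) l)) p)
      ... | inj₁ t∼l = merge-⊒ t∼l
      ... | inj₂ q with ∧-true⁻ q
      ...   | meets , joined with ∨-true⁻ meets | ∨-true⁻ joined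
      ...     | inj₁ t∼i | inj₁ i∼l = merge-⊒ (∼-trans t∼i i∼l)
      ...     | inj₁ t∼i | inj₂ j∼l = merge-joins (∼-sym t∼i) j∼l
      ...     | inj₂ t∼j | inj₁ i∼l = merge-joins′ (∼-sym t∼j) i∼l
      ...     | inj₂ t∼j | inj₂ j∼l = merge-⊒ (∼-trans t∼j j∼l)
      from : ∀ l → t ∼[ σ′ ] l → l ∈ₛ mergeSubset σ i j (lookup σ t)
      from l t∼l = trans (lookup-mergeSubset (lookup σ t) l) (joined (merge⁻ t∼l))
        where
        joined : JoinedBy t l → (rel σ t l ∨ ((rel σ t i ∨ rel σ t j) ∧ (rel σ i l ∨ rel σ j l))) ≡ true
        joined (inj₁ t∼l)                = ∨-trueˡ _ t∼l
        joined (inj₂ (inj₁ (i∼t , j∼l))) =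
          ∨-trueʳ (rel σ t l) (∧-true⁺ (∨-trueˡ _ (∼-sym i∼t)) (∨-trueʳ (rel σ i l) j∼l))
        joined (inj₂ (inj₂ (j∼t , i∼l))) =
          ∨-trueʳ (rel σ t l) (∧-true⁺ (∨-trueʳ (rel σ t i) (∼-sym j∼t)) (∨-trueˡ _ i∼l))

    module _ (ρ : Rel n) (isPρ : IsPartition ρ) (σ⊑ρ : σ refines ρ) where

      private module ρ = Partition ρ isPρ

      merge-least : i ∼[ ρ ] j → σ′ refines ρ
      merge-least i∼j a b a∼b with merge⁻ a∼b
      ... | inj₁ a∼σb               = σ⊑ρ a b a∼σb
      ... | inj₂ (inj₁ (i∼a , j∼b)) = ρ.∼-trans (σ⊑ρ a i (∼-sym i∼a)) (ρ.∼-trans i∼j (σ⊑ρ j b j∼b))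
      ... | inj₂ (inj₂ (j∼a , i∼b)) = ρ.∼-trans (σ⊑ρ a j (∼-sym j∼a)) (ρ.∼-trans (ρ.∼-sym i∼j) (σ⊑ρ i b i∼b))

      new-pair⇒joined : ∀ {k l} → k ∼[ ρ ] l → ¬ k ∼[ σ ] l → k ∼[ σ′ ] l → i ∼[ ρ ] j
      new-pair⇒joined {k} {l} k∼l k≁l k∼′l with merge⁻ k∼′l
      ... | inj₁ k∼σl               = ⊥-elim (k≁l k∼σl)
      ... | inj₂ (inj₁ (i∼k , j∼l)) = ρ.∼-trans (σ⊑ρ i k i∼k) (ρ.∼-trans k∼l (σ⊑ρ l j (∼-sym j∼l)))
      ... | inj₂ (inj₂ (j∼k , i∼l)) = ρ.∼-sym (ρ.∼-trans (σ⊑ρ j k j∼k) (ρ.∼-trans k∼l (σ⊑ρ l i (∼-sym i∼l))))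

gaps : ∀ {m n} → Vec (Subset n) m → ℕ
gaps []       = 0
gaps (r ∷ rs) = ∣ ∁ r ∣ + gaps rs

gaps-mono : ∀ {m n} (U V : Vec (Subset n) m) → (∀ a → lookup U a ⊆ lookup V a) → gaps V ≤ gaps U
gaps-mono []      []      _    = z≤n
gaps-mono (u ∷ U) (v ∷ V) U⊆V =
  +-mono-≤ (Sub.p⊆q⇒∣p∣≤∣q∣ (Sub.p⊆q⇒∁p⊇∁q (U⊆V zero))) (gaps-mono U V (U⊆V ∘ suc))

gaps-strict : ∀ {m n} (U V : Vec (Subset n) m) → (∀ a → lookup U a ⊆ lookup V a) →
              ∀ a → lookup U a ⊂ lookup V a → gaps V < gaps U
gaps-strict (u ∷ U) (v ∷ V) U⊆V zero u⊂v =
  +-mono-<-≤ (Sub.p⊂q⇒∣p∣<∣q∣ (Sub.p⊂q⇒∁p⊃∁q u⊂v)) (gaps-mono U V (U⊆V ∘ suc))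
gaps-strict (u ∷ U) (v ∷ V) U⊆V (suc a) Ua⊂Va =
  +-mono-≤-< (Sub.p⊆q⇒∣p∣≤∣q∣ (Sub.p⊆q⇒∁p⊇∁q (U⊆V zero))) (gaps-strict U V (U⊆V ∘ suc) a Ua⊂Va)

gaps-refines : ∀ {n} (σ ρ : Rel n) → σ refines ρ → ∀ k l → k ∼[ ρ ] l → ¬ k ∼[ σ ] l → gaps ρ < gaps σ
gaps-refines σ ρ σ⊑ρ k l k∼l k≁l =
  gaps-strict σ ρ (λ a → ∈ₛ⇒⊆ (σ⊑ρ a)) k
    (∈ₛ⇒⊆ (σ⊑ρ k) , l , Vec.lookup⇒[]= l (lookup ρ k) k∼l , k≁l ∘ Vec.[]=⇒lookup)

discrete : ∀ {n} → Rel n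
discrete = tabulateᵛ ⁅_⁆

discrete⁻ : ∀ {n} {k l : Fin n} → k ∼[ discrete ] l → k ≡ l
discrete⁻ {k = k} {l} k∼l =
  sym (Sub.x∈⁅y⁆⇒x≡y k (Vec.lookup⇒[]= l ⁅ k ⁆ (trans (sym (cong (λ r → lookup r l) (Vec.lookup∘tabulate ⁅_⁆ k))) k∼l)))

discrete⁺ : ∀ {n} (k : Fin n) → k ∼[ discrete ] k
discrete⁺ k = trans (cong (λ r → lookup r k) (Vec.lookup∘tabulate ⁅_⁆ k)) (Vec.[]=⇒lookup (Sub.x∈⁅x⁆ k))

discrete-isPartition : ∀ {n} → IsPartition (discrete {n})
discrete-isPartition =
  discrete⁺ , (λ k l k∼l → subst (_∼[ discrete ] k) (discrete⁻ k∼l) (discrete⁺ k)) ,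
  λ k l m k∼l l∼m → subst (k ∼[ discrete ]_) (trans (discrete⁻ k∼l) (discrete⁻ l∼m)) (discrete⁺ k)

discrete-refines : ∀ {n} (ρ : Rel n) → IsPartition ρ → discrete refines ρ
discrete-refines ρ isPρ k l k∼l = subst (k ∼[ ρ ]_) (discrete⁻ k∼l) (proj₁ isPρ k)

atom : ∀ {n} → Fin n → Elem n
atom i = emb (lookup discrete i) discrete

atom-valid : ∀ {n} (i : Fin n) → Valid (atom i)
atom-valid i = discrete-isPartition , i , refl

NewPair : ∀ {n} → Rel n → Rel n → Set
NewPair {n} σ ρ = ∃[ k ] ∃[ l ] k ∼[ ρ ] l × ¬ k ∼[ σ ] l

newPair? : ∀ {n} (σ ρ : Rel n) → Dec (NewPair σ ρ)
newPair? σ ρ = Fin.any? λ k → Fin.any? λ l → k ∼[ ρ ]? l ×-dec ¬? (k ∼[ σ ]? l)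

¬NewPair⇒refines : ∀ {n} (σ ρ : Rel n) → ¬ NewPair σ ρ → ρ refines σ
¬NewPair⇒refines σ ρ none k l k∼l with k ∼[ σ ]? l
... | yes k∼σl = k∼σl
... | no k≁σl  = ⊥-elim (none (k , l , k∼l , k≁σl))

-- The covers of an element below Sπ

block-∋-rep : ∀ {n} {T : Subset n} ρ (vw : Valid (emb T ρ)) → proj₁ (proj₂ vw) ∈ₛ T
block-∋-rep ρ (isPρ , t , T≡) = subst (t ∈ₛ_) (sym T≡) (proj₁ isPρ t)

module _ {n} {T : Subset n} (σ : Rel n) (vx : Valid (emb T σ)) where

  private
    t : Fin n
    t = proj₁ (proj₂ vx)

  ⊆⇒block-≡ : ∀ {T′} ρ → Valid (emb T′ ρ) → T ⊆ T′ → T′ ≡ lookup ρ t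
  ⊆⇒block-≡ ρ (isPρ , t′ , T′≡) T⊆T′ =
    trans T′≡ (Partition.block-≡ ρ isPρ (subst (t ∈ₛ_) T′≡ (⊆⇒∈ₛ T⊆T′ (block-∋-rep σ vx))))

  ⊑-refines⇒≡ : ∀ {T′} ρ → Valid (emb T′ ρ) → emb T σ ⊑ emb T′ ρ → ρ refines σ → emb T′ ρ ≡ emb T σ
  ⊑-refines⇒≡ ρ vw (T⊆T′ , σ⊑ρ) ρ⊑σ with refines-antisym σ ρ σ⊑ρ ρ⊑σ
  ... | refl = cong₂ emb (trans (⊆⇒block-≡ σ vw T⊆T′) (sym (proj₂ (proj₂ vx)))) refl

  module MergeStep (i j : Fin n) where

    open Merge σ i j

    merged : Elem n
    merged = mergeElem T σ (i , j)

    mergeSubset-≡ : mergeSubset σ i j T ≡ lookup σ′ t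
    mergeSubset-≡ = trans (cong (mergeSubset σ i j) (proj₂ (proj₂ vx))) (mergeSubset-block (proj₁ vx) t)

    merged-valid : Valid merged
    merged-valid = merge-isPartition (proj₁ vx) , t , mergeSubset-≡

    ⊑-merged : emb T σ ⊑ merged
    ⊑-merged = ∈ₛ⇒⊆ (λ _ → mergeSubset-⊇ T) , λ _ _ → merge-⊒

    ≢-merged : IsRep σ i → IsRep σ j → i Fin.< j → emb T σ ≢ merged
    ≢-merged rep-i rep-j i<j x≡merged =
      Fin.<-irrefl (Representatives.rep-unique σ (proj₁ vx) rep-i rep-j i∼j) i<j
      where
      i∼j : i ∼[ σ ] j
      i∼j = subst (λ R → i ∼[ R ] j) (sym (cong (λ { bot → σ ; (emb _ R) → R }) x≡merged))
                  (merge-joins (proj₁ (proj₁ vx) i) (proj₁ (proj₁ vx) j))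

    merged-⊑ : ∀ {T′} ρ → Valid (emb T′ ρ) → emb T σ ⊑ emb T′ ρ → σ′ refines ρ → merged ⊑ emb T′ ρ
    merged-⊑ ρ vw (T⊆T′ , _) σ′⊑ρ =
      subst (mergeSubset σ i j T ⊆_) (sym (⊆⇒block-≡ ρ vw T⊆T′)) (subst (_⊆ _) (sym mergeSubset-≡) (∈ₛ⇒⊆ (σ′⊑ρ t))) ,
      σ′⊑ρ

    merged-between : ∀ w → Valid w → emb T σ ⊑ w → w ⊑ merged → w ≡ emb T σ ⊎ w ≡ merged
    merged-between (emb T′ ρ) vw@(isPρ , _) x⊑w@(_ , σ⊑ρ) w⊑merged@(_ , ρ⊑σ′) with newPair? σ ρ
    ... | no none = inj₁ (⊑-refines⇒≡ ρ vw x⊑w (¬NewPair⇒refines σ ρ none))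
    ... | yes (k , l , k∼l , k≁l) =
      inj₂ (⊑-antisym w⊑merged (merged-⊑ ρ vw x⊑w
              (merge-least (proj₁ vx) ρ isPρ σ⊑ρ (new-pair⇒joined (proj₁ vx) ρ isPρ σ⊑ρ k∼l k≁l (ρ⊑σ′ k l k∼l)))))

module _ {n} (T : Subset n) (σ : Rel n) (isPσ : IsPartition σ) where

  open Partition σ isPσ
  open Representatives σ isPσ

  mergeElem-injective : ∀ {i j i′ j′} → IsRep σ i → IsRep σ j → IsRep σ i′ → IsRep σ j′ → i Fin.< j → i′ Fin.< j′ →
                        mergeElem T σ (i , j) ≡ mergeElem T σ (i′ , j′) → (i , j) ≡ (i′ , j′)
  mergeElem-injective {i} {j} {i′} {j′} rep-i rep-j rep-i′ rep-j′ i<j i′<j′ eq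
    with Merge.merge⁻ σ i′ j′ (subst (λ R → i ∼[ R ] j) (cong relOf eq) (Merge.merge-joins σ i j (∼-refl i) (∼-refl j)))
    where
    relOf : Elem n → Rel n
    relOf bot       = σ
    relOf (emb _ R) = R
  ... | inj₁ i∼j                  = ⊥-elim (Fin.<-irrefl (rep-unique rep-i rep-j i∼j) i<j)
  ... | inj₂ (inj₁ (i′∼i , j′∼j)) = cong₂ _,_ (sym (rep-unique rep-i′ rep-i i′∼i)) (sym (rep-unique rep-j′ rep-j j′∼j))
  ... | inj₂ (inj₂ (j′∼i , i′∼j)) with rep-unique rep-j′ rep-i j′∼i | rep-unique rep-i′ rep-j i′∼j
  ...   | refl | refl = ⊥-elim (Fin.<-asym i<j i′<j′)

module _ {n} (σ : Rel n) (isPσ : IsPartition σ) {i j} (rep-i : IsRep σ i) (rep-j : IsRep σ j) (i<j : i Fin.< j) where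

  open Merge σ i j
  open Partition σ isPσ
  open Representatives σ isPσ

  isRep-merge⁻ : ∀ {k} → IsRep σ′ k → IsRep σ k × k ≢ j
  isRep-merge⁻ rep-k = (λ k′ k′<k k′∼k → rep-k k′ k′<k (merge-⊒ k′∼k)) ,
                       λ { refl → rep-k i i<j (merge-joins (∼-refl i) (∼-refl j)) }

  isRep-merge⁺ : ∀ {k} → IsRep σ k → k ≢ j → IsRep σ′ k
  isRep-merge⁺ rep-k k≢j k′ k′<k k′∼k with merge⁻ k′∼k
  ... | inj₁ k′∼σk              = rep-k k′ k′<k k′∼σk
  ... | inj₂ (inj₁ (_ , j∼k))   = k≢j (sym (rep-unique rep-j rep-k j∼k))
  ... | inj₂ (inj₂ (j∼k′ , i∼k)) with rep-unique rep-i rep-k i∼k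
  ...   | refl = rep-j k′ (Fin.<-trans k′<k i<j) (∼-sym j∼k′)

record JoiningMerge {n} (σ : Rel n) (k l : Fin n) : Set where
  field
    i j   : Fin n
    rep-i : IsRep σ i
    rep-j : IsRep σ j
    i<j   : i Fin.< j
    joins : k ∼[ merge σ i j ] l

joiningMerge : ∀ {n} (σ : Rel n) → IsPartition σ → ∀ {k l} → ¬ k ∼[ σ ] l → JoiningMerge σ k l
joiningMerge σ isPσ {k} {l} k≁l with rep k | rep l
  where open Representatives σ isPσ
... | rk , rk∼k , rep-rk | rl , rl∼l , rep-rl with Fin.<-cmp rk rl
...   | tri< rk<rl _ _ = record { rep-i = rep-rk ; rep-j = rep-rl ; i<j = rk<rl ; joins = Merge.merge-joins σ rk rl rk∼k rl∼l }
...   | tri≈ _ refl _  = ⊥-elim (k≁l (∼-trans (∼-sym rk∼k) rl∼l))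
  where open Partition σ isPσ
...   | tri> _ _ rl<rk = record { rep-i = rep-rl ; rep-j = rep-rk ; i<j = rl<rk ; joins = Merge.merge-joins′ σ rl rk rk∼k rl∼l }

atom-⊑ : ∀ {n} {T : Subset n} ρ (vw : Valid (emb T ρ)) → atom (proj₁ (proj₂ vw)) ⊑ emb T ρ
atom-⊑ {T = T} ρ (isPρ , t , T≡) =
  ∈ₛ⇒⊆ (λ l t∼l → subst (l ∈ₛ_) (sym T≡) (subst (t ∼[ ρ ]_) (discrete⁻ t∼l) (proj₁ isPρ t))) ,
  discrete-refines ρ isPρ

module CoversBelow {n} (S : Subset n) (π : Rel n) (vy : Valid (emb S π)) where

  y : Elem n
  y = emb S π

  open MaximalChains y using (_⋖_; CoverListing)

  private
    module π  = Partition π (proj₁ vy)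
    module πR = Representatives π (proj₁ vy)

  πReps : List (Fin n)
  πReps = blockReps π

  σRep? : ∀ σ b k → Dec (IsRep σ k × k ∼[ π ] b)
  σRep? σ b k = isRep? σ k ×-dec k ∼[ π ]? b

  σReps : Rel n → Fin n → List (Fin n)
  σReps σ b = filter (σRep? σ b) (allFin n)

  ∈-πReps⁻ : ∀ {b} → b ∈ πReps → IsRep π b
  ∈-πReps⁻ = ∈-blockReps⁻ π

  ∈-πReps⁺ : ∀ {b} → IsRep π b → b ∈ πReps
  ∈-πReps⁺ = ∈-blockReps⁺ π

  ∈-σReps⁻ : ∀ σ b {k} → k ∈ σReps σ b → IsRep σ k × k ∼[ π ] b
  ∈-σReps⁻ σ b k∈ = proj₂ (∈-filter⁻ (σRep? σ b) {xs = allFin n} k∈)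

  ∈-σReps⁺ : ∀ σ b {k} → IsRep σ k → k ∼[ π ] b → k ∈ σReps σ b
  ∈-σReps⁺ σ b {k} rep-k k∼b = ∈-filter⁺ (σRep? σ b) (∈-allFin k) (rep-k , k∼b)

  unique-πReps : Unique πReps
  unique-πReps = unique-blockReps π

  unique-σReps : ∀ σ b → Unique (σReps σ b)
  unique-σReps σ b = Unique.filter⁺ _ (Unique.allFin⁺ n)

  sorted-σReps : ∀ σ b → AllPairs Fin._<_ (σReps σ b)
  sorted-σReps σ b = AllPairs.filter⁺ _ (AllPairs.tabulate⁺-< id)

  record MergePair (σ : Rel n) : Set where
    field
      b i j : Fin n
      b∈    : b ∈ πReps
      i∈    : i ∈ σReps σ b
      j∈    : j ∈ σReps σ b
      i<j   : i Fin.< j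

    rep-i : IsRep σ i
    rep-i = proj₁ (∈-σReps⁻ σ b i∈)

    rep-j : IsRep σ j
    rep-j = proj₁ (∈-σReps⁻ σ b j∈)

    i∼j : i ∼[ π ] j
    i∼j = π.∼-trans (proj₂ (∈-σReps⁻ σ b i∈)) (π.∼-sym (proj₂ (∈-σReps⁻ σ b j∈)))

  mergePair : ∀ {σ i j} → IsRep σ i → IsRep σ j → i Fin.< j → i ∼[ π ] j → MergePair σ
  mergePair {σ} {i} {j} rep-i rep-j i<j i∼j = record
    { b = b ; i = i ; j = j ; b∈ = ∈-πReps⁺ rep-b
    ; i∈ = ∈-σReps⁺ σ b rep-i (π.∼-sym b∼i)
    ; j∈ = ∈-σReps⁺ σ b rep-j (π.∼-trans (π.∼-sym i∼j) (π.∼-sym b∼i))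
    ; i<j = i<j }
    where
    b : Fin n
    b = proj₁ (πR.rep i)
    b∼i : b ∼[ π ] i
    b∼i = proj₁ (proj₂ (πR.rep i))
    rep-b : IsRep π b
    rep-b = proj₂ (proj₂ (πR.rep i))

  mergeCovers : Subset n → Rel n → List (Elem n)
  mergeCovers T σ = concatMap (λ b → map (mergeElem T σ) (pairs (σReps σ b))) πReps

  ∈-mergeCovers⁺ : ∀ {T σ} (p : MergePair σ) → let open MergePair p in mergeElem T σ (i , j) ∈ mergeCovers T σ
  ∈-mergeCovers⁺ {T} {σ} p =
    ∈-concatMap-intro (λ b → map (mergeElem T σ) (pairs (σReps σ b))) b∈
      (∈-map⁺ (mergeElem T σ) (∈-pairs⁺ (Fin.<-irrefl refl) Fin.<-asym (sorted-σReps σ b) i∈ j∈ i<j))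
    where open MergePair p

  ∈-mergeCovers⁻ : ∀ {T σ z} → z ∈ mergeCovers T σ →
                   Σ (MergePair σ) λ p → z ≡ mergeElem T σ (MergePair.i p , MergePair.j p)
  ∈-mergeCovers⁻ {T} {σ} z∈ with ∈-concatMap-elim (λ b → map (mergeElem T σ) (pairs (σReps σ b))) {πReps} z∈
  ... | b , b∈ , z∈′ with ∈-map⁻ (mergeElem T σ) z∈′
  ...   | (i , j) , ij∈ , refl with ∈-pairs⁻ {xs = σReps σ b} ij∈
  ...     | i∈ , j∈ = record { b = b ; i = i ; j = j ; b∈ = b∈ ; i∈ = i∈ ; j∈ = j∈
                             ; i<j = ∈-pairs-related (sorted-σReps σ b) ij∈ } , refl

  merge-⋖ : ∀ {T σ i j} (vx : Valid (emb T σ)) → emb T σ ⊑ y → IsRep σ i → IsRep σ j → i Fin.< j →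
            i ∼[ π ] j → emb T σ ⋖ mergeElem T σ (i , j)
  merge-⋖ {T} {σ} {i} {j} vx x⊑y@(_ , σ⊑π) rep-i rep-j i<j i∼j =
    merged-valid , (⊑-merged , ≢-merged rep-i rep-j i<j) ,
    merged-⊑ π vy x⊑y (Merge.merge-least σ i j (proj₁ vx) π (proj₁ vy) σ⊑π i∼j) ,
    merged-between
    where open MergeStep σ vx i j

  mergeCovers-unique : ∀ {T σ} → IsPartition σ → Unique (mergeCovers T σ)
  mergeCovers-unique {T} {σ} isPσ =
    unique-concatMap _ (All.tabulate λ {b} _ → unique-map-injectiveOn (mergeElem T σ) (unique-pairs (unique-σReps σ b)) injective)
      (allPairs-distinct unique-πReps λ b∈ b′∈ b≢b′ (z∈ , z∈′) → disjoint b∈ b′∈ b≢b′ z∈ z∈′)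
    where
    injective : ∀ {b b′ p p′} → p ∈ pairs (σReps σ b) → p′ ∈ pairs (σReps σ b′) →
                mergeElem T σ p ≡ mergeElem T σ p′ → p ≡ p′
    injective {b} {b′} {i , j} {i′ , j′} p∈ p′∈ =
      let i∈ , j∈ = ∈-pairs⁻ {xs = σReps σ b} p∈ ; i′∈ , j′∈ = ∈-pairs⁻ {xs = σReps σ b′} p′∈ in
      mergeElem-injective T σ isPσ (proj₁ (∈-σReps⁻ σ b i∈)) (proj₁ (∈-σReps⁻ σ b j∈))
        (proj₁ (∈-σReps⁻ σ b′ i′∈)) (proj₁ (∈-σReps⁻ σ b′ j′∈))
        (∈-pairs-related (sorted-σReps σ b) p∈) (∈-pairs-related (sorted-σReps σ b′) p′∈)
    disjoint : ∀ {b b′ z} → b ∈ πReps → b′ ∈ πReps → b ≢ b′ →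
               z ∈ map (mergeElem T σ) (pairs (σReps σ b)) → z ∈ map (mergeElem T σ) (pairs (σReps σ b′)) → ⊥
    disjoint {b} {b′} b∈ b′∈ b≢b′ z∈ z∈′ with ∈-map⁻ (mergeElem T σ) z∈ | ∈-map⁻ (mergeElem T σ) z∈′
    ... | p , p∈ , refl | p′ , p′∈ , eq with injective {b} {b′} p∈ p′∈ eq
    ...   | refl = b≢b′ (πR.rep-unique (∈-πReps⁻ b∈) (∈-πReps⁻ b′∈) (π.∼-trans (π.∼-sym i∼b) i∼b′))
      where
      i∼b : proj₁ p ∼[ π ] b
      i∼b = proj₂ (∈-σReps⁻ σ b (proj₁ (∈-pairs⁻ {xs = σReps σ b} p∈)))
      i∼b′ : proj₁ p ∼[ π ] b′
      i∼b′ = proj₂ (∈-σReps⁻ σ b′ (proj₁ (∈-pairs⁻ {xs = σReps σ b′} p′∈)))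

  ⋖⇒∈-mergeCovers : ∀ {T σ T′ ρ i j k l} (vx : Valid (emb T σ)) → emb T σ ⋖ emb T′ ρ →
    IsRep σ i → IsRep σ j → i Fin.< j → k ∼[ ρ ] l → ¬ k ∼[ σ ] l → k ∼[ merge σ i j ] l →
    emb T′ ρ ∈ mergeCovers T σ
  ⋖⇒∈-mergeCovers {T} {σ} {T′} {ρ} {i} {j} vx@(isPσ , _)
    (vz@(isPρ , _) , (x⊑z@(_ , σ⊑ρ) , _) , (_ , ρ⊑π) , between) rep-i rep-j i<j k∼l k≁l k∼′l =
    subst (_∈ mergeCovers T σ) merged≡z (∈-mergeCovers⁺ {T} pair)
    where
    open MergeStep σ vx i j
    σ′⊑ρ : merge σ i j refines ρ
    σ′⊑ρ = Merge.merge-least σ i j isPσ ρ isPρ σ⊑ρ (Merge.new-pair⇒joined σ i j isPσ ρ isPρ σ⊑ρ k∼l k≁l k∼′l)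
    pair : MergePair σ
    pair = mergePair rep-i rep-j i<j (ρ⊑π i j (σ′⊑ρ i j (Merge.merge-joins σ i j (proj₁ isPσ i) (proj₁ isPσ j))))
    merged≡z : mergeElem T σ (i , j) ≡ emb T′ ρ
    merged≡z with between merged merged-valid ⊑-merged (merged-⊑ ρ vz x⊑z σ′⊑ρ)
    ... | inj₁ merged≡x = ⊥-elim (≢-merged rep-i rep-j i<j (sym merged≡x))
    ... | inj₂ merged≡z = merged≡z

  mergeCovers-complete : ∀ {T σ} (vx : Valid (emb T σ)) → emb T σ ⊑ y → ∀ {z} → emb T σ ⋖ z → z ∈ mergeCovers T σ
  mergeCovers-complete     vx x⊑y {bot} (_ , (() , _) , _)
  mergeCovers-complete {T} {σ} vx@(isPσ , _) x⊑y {emb T′ ρ} x⋖z@(vz , (x⊑z , x≢z) , _) with newPair? σ ρ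
  ... | no none = ⊥-elim (x≢z (sym (⊑-refines⇒≡ σ vx ρ vz x⊑z (¬NewPair⇒refines σ ρ none))))
  ... | yes (k , l , k∼l , k≁l) = ⋖⇒∈-mergeCovers vx x⋖z rep-i rep-j i<j k∼l k≁l joins
    where open JoiningMerge (joiningMerge σ isPσ k≁l)

  atom-⋖ : ∀ {i} → i ∈ₛ S → bot ⋖ atom i
  atom-⋖ {i} i∈S =
    atom-valid i , (tt , λ ()) , (∈ₛ⇒⊆ (λ l i∼l → subst (_∈ₛ S) (discrete⁻ i∼l) i∈S) , discrete-refines π (proj₁ vy)) ,
    between
    where
    between : ∀ w → Valid w → bot ⊑ w → w ⊑ atom i → w ≡ bot ⊎ w ≡ atom i
    between bot       _  _ _               = inj₁ refl
    between (emb T ρ) vw _ w⊑atom@(T⊆i , _) =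
      inj₂ (⊑-antisym w⊑atom (subst (λ u → atom u ⊑ emb T ρ) (sym (discrete⁻ (⊆⇒∈ₛ T⊆i (block-∋-rep ρ vw)))) (atom-⊑ ρ vw)))

  atomCovers-complete : ∀ {z} → bot ⋖ z → z ∈ map atom (members S)
  atomCovers-complete {bot}     (_ , (_ , bot≢bot) , _) = ⊥-elim (bot≢bot refl)
  atomCovers-complete {emb T ρ} (vz@(_ , t , _) , _ , (T⊆S , _) , between)
    with between (atom t) (atom-valid t) tt (atom-⊑ ρ vz)
  ... | inj₂ atom≡z = subst (_∈ map atom (members S)) atom≡z
                        (∈-map⁺ atom (∈-filter⁺ (λ k → lookup S k ≟ᵇ true) (∈-allFin t) (⊆⇒∈ₛ T⊆S (block-∋-rep ρ vz))))

  atomCovers-unique : Unique (map atom (members S))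
  atomCovers-unique = unique-map-injectiveOn atom (Unique.filter⁺ _ (Unique.allFin⁺ n)) λ {i} {j} _ _ atom≡ →
    discrete⁻ (subst (j ∈ₛ_) (sym (cong (λ { bot → S ; (emb T _) → T }) atom≡)) (discrete⁺ j))

  covers : Elem n → List (Elem n)
  covers bot       = map atom (members S)
  covers (emb T σ) = mergeCovers T σ

  rank : Elem n → ℕ
  rank bot       = suc (gaps (discrete {n}))
  rank (emb _ σ) = gaps σ

  listing : CoverListing
  listing = record
    { covers          = covers
    ; rank            = rank
    ; covers-unique   = λ { bot _ _ → atomCovers-unique ; (emb T σ) (isPσ , _) _ → mergeCovers-unique {T} {σ} isPσ }
    ; covers-sound    = sound
    ; covers-complete = λ { bot _ _ → atomCovers-complete ; (emb T σ) vx x⊑y → mergeCovers-complete {T} {σ} vx x⊑y }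
    ; rank-covers     = rank-decreases
    }
    where
    sound : ∀ x → Valid x → x ⊑ y → ∀ {z} → z ∈ covers x → x ⋖ z
    sound bot _ _ z∈ with ∈-map⁻ atom z∈
    ... | i , i∈ , refl = atom-⋖ (proj₂ (∈-filter⁻ (λ k → lookup S k ≟ᵇ true) {xs = allFin n} i∈))
    sound (emb T σ) vx x⊑y z∈ with ∈-mergeCovers⁻ {T} {σ} z∈
    ... | p , refl = merge-⋖ vx x⊑y rep-i rep-j i<j i∼j
      where open MergePair p
    rank-decreases : ∀ x → Valid x → x ⊑ y → ∀ {z} → z ∈ covers x → rank z < rank x
    rank-decreases bot _ _ z∈ with ∈-map⁻ atom z∈
    ... | _ , _ , refl = n<1+n _
    rank-decreases (emb T σ) (isPσ , _) _ z∈ with ∈-mergeCovers⁻ {T} {σ} z∈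
    ... | p , refl = gaps-refines σ σ′ (λ _ _ → merge-⊒) i j (merge-joins (∼-refl i) (∼-refl j))
                       (λ i∼j → Fin.<-irrefl (Representatives.rep-unique σ isPσ rep-i rep-j i∼j) i<j)
      where
      open MergePair p
      open Merge σ i j
      open Partition σ isPσ

  open MaximalChains.CoverListing listing public using (rank-covers)
  open MaximalChains.Enumeration y listing public

-- Counting the maximal chains of [Tσ, Sπ]

module ChainCounting {n} (S : Subset n) (π : Rel n) (vy : Valid (emb S π)) where

  open CoversBelow S π vy public

  private
    module π  = Partition π (proj₁ vy)
    module πR = Representatives π (proj₁ vy)

  blockCount : Rel n → Fin n → ℕ
  blockCount σ b = length (σReps σ b)

  excess : Rel n → ℕ
  excess σ = sum (map (λ b → blockCount σ b ∸ 1) πReps)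

  weight : Rel n → ℕ
  weight σ = product (map (λ b → blockCount σ b !) πReps)

  module AfterMerge {σ} (isPσ : IsPartition σ) (p : MergePair σ) where

    open MergePair p
    open Merge σ i j using (σ′)

    blockCount-merged : suc (blockCount σ′ b) ≡ blockCount σ b
    blockCount-merged =
      trans (cong (suc ∘ length) (filter-≐ (σRep? σ′ b) (λ k → σRep? σ b k ×-dec ¬? (k Fin.≟ j)) (to , from) (allFin n)))
            (length-filter-remove (σRep? σ b) Fin._≟_ (Unique.allFin⁺ n) (∈-allFin j) (∈-σReps⁻ σ b j∈))
      where
      to : ∀ {k} → IsRep σ′ k × k ∼[ π ] b → (IsRep σ k × k ∼[ π ] b) × k ≢ j
      to (rep-k , k∼b) = let rep-σk , k≢j = isRep-merge⁻ σ isPσ rep-i rep-j i<j rep-k in (rep-σk , k∼b) , k≢j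
      from : ∀ {k} → (IsRep σ k × k ∼[ π ] b) × k ≢ j → IsRep σ′ k × k ∼[ π ] b
      from ((rep-k , k∼b) , k≢j) = isRep-merge⁺ σ isPσ rep-i rep-j i<j rep-k k≢j , k∼b

    blockCount-other : ∀ {b′} → b′ ∈ πReps → b′ ≢ b → blockCount σ′ b′ ≡ blockCount σ b′
    blockCount-other {b′} b′∈ b′≢b = cong length (filter-≐ (σRep? σ′ b′) (σRep? σ b′) (to , from) (allFin n))
      where
      to : ∀ {k} → IsRep σ′ k × k ∼[ π ] b′ → IsRep σ k × k ∼[ π ] b′
      to (rep-k , k∼b′) = proj₁ (isRep-merge⁻ σ isPσ rep-i rep-j i<j rep-k) , k∼b′
      from : ∀ {k} → IsRep σ k × k ∼[ π ] b′ → IsRep σ′ k × k ∼[ π ] b′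
      from (rep-k , k∼b′) = isRep-merge⁺ σ isPσ rep-i rep-j i<j rep-k k≢j , k∼b′
        where
        k≢j : _ ≢ j
        k≢j refl = b′≢b (πR.rep-unique (∈-πReps⁻ b′∈) (∈-πReps⁻ b∈)
                                        (π.∼-trans (π.∼-sym k∼b′) (proj₂ (∈-σReps⁻ σ b j∈))))

    2≤blockCount : 2 ≤ blockCount σ b
    2≤blockCount = 2≤length i∈ j∈ λ { refl → Fin.<-irrefl refl i<j }

    excess-merge : excess σ ≡ suc (excess σ′)
    excess-merge = +-cancelʳ-≡ (f b) _ _ (trans (sym update) (trans (cong (excess σ′ +_) gb≡) (+-suc _ _)))
      where
      f g : Fin n → ℕ
      f b′ = blockCount σ′ b′ ∸ 1
      g b′ = blockCount σ b′ ∸ 1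
      update : excess σ′ + g b ≡ excess σ + f b
      update = sum-map-update f g unique-πReps b∈ (All.tabulate λ b′∈ b′≢b → cong (_∸ 1) (blockCount-other b′∈ b′≢b))
      gb≡ : g b ≡ suc (f b)
      gb≡ = pred-of-suc (blockCount σ′ b) blockCount-merged 2≤blockCount
        where
        pred-of-suc : ∀ a {c} → suc a ≡ c → 2 ≤ c → c ∸ 1 ≡ suc (a ∸ 1)
        pred-of-suc zero    refl (s≤s ())
        pred-of-suc (suc a) refl _ = refl

    weight-merge : blockCount σ b * weight σ′ ≡ weight σ
    weight-merge = *-cancelʳ-≡ _ _ (f b) {{blockCount σ′ b !≢0}}
      (begin
        blockCount σ b * weight σ′ * f b    ≡⟨ *-assoc (blockCount σ b) (weight σ′) (f b) ⟩
        blockCount σ b * (weight σ′ * f b)  ≡⟨ cong (blockCount σ b *_) (*-comm (weight σ′) (f b)) ⟩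
        blockCount σ b * (f b * weight σ′)  ≡⟨ *-assoc (blockCount σ b) (f b) (weight σ′) ⟨
        blockCount σ b * f b * weight σ′    ≡⟨ cong (_* weight σ′) gb≡ ⟨
        g b * weight σ′                     ≡⟨ *-comm (g b) (weight σ′) ⟩
        weight σ′ * g b                     ≡⟨ product-map-update f g unique-πReps b∈
                                                 (All.tabulate λ b′∈ b′≢b → cong _! (blockCount-other b′∈ b′≢b)) ⟩
        weight σ * f b                      ∎)
      where
      open ≡-Reasoning
      f g : Fin n → ℕ
      f b′ = blockCount σ′ b′ !
      g b′ = blockCount σ b′ !
      gb≡ : g b ≡ blockCount σ b * f b
      gb≡ = subst (λ c → c ! ≡ c * blockCount σ′ b !) blockCount-merged refl

  mergePair-below : ∀ {T σ} (vx : Valid (emb T σ)) → emb T σ ⊑ y → emb T σ ≢ y → MergePair σ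
  mergePair-below {T} {σ} vx@(isPσ , _) x⊑y@(_ , σ⊑π) x≢y with newPair? σ π
  ... | no none = ⊥-elim (x≢y (sym (⊑-refines⇒≡ σ vx π vy x⊑y (¬NewPair⇒refines σ π none))))
  ... | yes (k , l , k∼l , k≁l) =
    mergePair rep-i rep-j i<j (Merge.new-pair⇒joined σ i j isPσ π (proj₁ vy) σ⊑π k∼l k≁l joins)
    where open JoiningMerge (joiningMerge σ isPσ k≁l)

  blockCount-π≤1 : ∀ b → blockCount π b ≤ 1
  blockCount-π≤1 b = length≤1 (unique-σReps π b) λ a∈ a′∈ →
    πR.rep-unique (proj₁ (∈-σReps⁻ π b a∈)) (proj₁ (∈-σReps⁻ π b a′∈))
                  (π.∼-trans (proj₂ (∈-σReps⁻ π b a∈)) (π.∼-sym (proj₂ (∈-σReps⁻ π b a′∈))))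

  excess-π : excess π ≡ 0
  excess-π = trans (sum-map-const {xs = πReps} (All.tabulate λ {b} _ → ≤1⇒∸1≡0 (blockCount-π≤1 b))) (*-zeroʳ (length πReps))
    where
    ≤1⇒∸1≡0 : ∀ {a} → a ≤ 1 → a ∸ 1 ≡ 0
    ≤1⇒∸1≡0 z≤n       = refl
    ≤1⇒∸1≡0 (s≤s z≤n) = refl

  weight-π : weight π ≡ 1
  weight-π = product-map-ones {xs = πReps} (All.tabulate λ {b} _ → ≤1⇒!≡1 (blockCount-π≤1 b))
    where
    ≤1⇒!≡1 : ∀ {a} → a ≤ 1 → a ! ≡ 1
    ≤1⇒!≡1 z≤n       = refl
    ≤1⇒!≡1 (s≤s z≤n) = refl

  module _ {T σ} (vx : Valid (emb T σ)) (x⊑y : emb T σ ⊑ y) (x≢y : emb T σ ≢ y) (f : ℕ) where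

    private
      isPσ : IsPartition σ
      isPσ = proj₁ vx
      p₀ : MergePair σ
      p₀ = mergePair-below vx x⊑y x≢y
      d : ℕ
      d = excess (merge σ (MergePair.i p₀) (MergePair.j p₀))
      excess≡ : excess σ ≡ suc d
      excess≡ = AfterMerge.excess-merge isPσ p₀
      K : ℕ
      K = d ! * weight σ
      chainsThrough : Fin n → ℕ
      chainsThrough b = sum (map (chainCount f) (map (mergeElem T σ) (pairs (σReps σ b))))

    chainCount-formula-step :
      (∀ (p : MergePair σ) → let open MergePair p in
        2 ^ excess (merge σ i j) * chainCount f (mergeElem T σ (i , j)) ≡ excess (merge σ i j) ! * weight (merge σ i j)) →
      2 ^ excess σ * chainCount (suc f) (emb T σ) ≡ excess σ ! * weight σ
    chainCount-formula-step formula-above =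
      begin
        2 ^ excess σ * chainCount (suc f) (emb T σ)
      ≡⟨ cong₂ (λ e c → 2 ^ e * c) excess≡ (chainCount-step f (emb T σ) x≢y) ⟩
        2 ^ suc d * sum (map (chainCount f) (mergeCovers T σ))
      ≡⟨ cong (2 ^ suc d *_) (sum-map-concatMap (chainCount f) (λ b → map (mergeElem T σ) (pairs (σReps σ b))) πReps) ⟩
        2 ^ suc d * sum (map chainsThrough πReps)
      ≡⟨ *-sum-map chainsThrough (2 ^ suc d) πReps ⟩
        sum (map (λ b → 2 ^ suc d * chainsThrough b) πReps)
      ≡⟨ sum-map-cong (All.tabulate per-block) ⟩
        sum (map (λ b → (blockCount σ b ∸ 1) * K) πReps)
      ≡⟨ sum-map-*ʳ (λ b → blockCount σ b ∸ 1) K πReps ⟩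
        excess σ * K
      ≡⟨ cong (_* K) excess≡ ⟩
        suc d * (d ! * weight σ)
      ≡⟨ *-assoc (suc d) (d !) (weight σ) ⟨
        suc d ! * weight σ
      ≡⟨ cong (λ e → e ! * weight σ) excess≡ ⟨
        excess σ ! * weight σ
      ∎
      where
      open ≡-Reasoning
      term : (p : MergePair σ) → let open MergePair p in
             blockCount σ b * (2 ^ d * chainCount f (mergeElem T σ (i , j))) ≡ K
      term p =
        begin
          m * (2 ^ d * c)                ≡⟨ cong (λ e → m * (2 ^ e * c)) excess′≡ ⟨
          m * (2 ^ excess σ′ * c)        ≡⟨ cong (m *_) (formula-above p) ⟩
          m * (excess σ′ ! * weight σ′)  ≡⟨ swap m (excess σ′ !) (weight σ′) ⟩
          excess σ′ ! * (m * weight σ′)  ≡⟨ cong₂ (λ e w → e ! * w) excess′≡ (AfterMerge.weight-merge isPσ p) ⟩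
          d ! * weight σ                 ∎
        where
        open MergePair p
        σ′ : Rel n
        σ′ = merge σ i j
        m c : ℕ
        m = blockCount σ b
        c = chainCount f (mergeElem T σ (i , j))
        excess′≡ : excess σ′ ≡ d
        excess′≡ = suc-injective (trans (sym (AfterMerge.excess-merge isPσ p)) excess≡)
        swap : ∀ a b c → a * (b * c) ≡ b * (a * c)
        swap = solve-∀
      per-block : ∀ {b} → b ∈ πReps → 2 ^ suc d * chainsThrough b ≡ (blockCount σ b ∸ 1) * K
      per-block {b} b∈ =
        begin
          2 ^ suc d * chainsThrough b
        ≡⟨ *-assoc 2 (2 ^ d) (chainsThrough b) ⟩
          2 * (2 ^ d * chainsThrough b)
        ≡⟨ cong (λ s → 2 * (2 ^ d * s)) (cong sum (sym (map-∘ (pairs (σReps σ b))))) ⟩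
          2 * (2 ^ d * sum (map (chainCount f ∘ mergeElem T σ) (pairs (σReps σ b))))
        ≡⟨ sum-pairs-uniform (σReps σ b) (chainCount f ∘ mergeElem T σ) (2 ^ d) K (All.tabulate pair-term) ⟩
          (blockCount σ b ∸ 1) * K
        ∎
        where
        pair-term : ∀ {ij} → ij ∈ pairs (σReps σ b) → blockCount σ b * (2 ^ d * chainCount f (mergeElem T σ ij)) ≡ K
        pair-term {i , j} ij∈ =
          let i∈ , j∈ = ∈-pairs⁻ {xs = σReps σ b} ij∈ in
          term (record { b = b ; i = i ; j = j ; b∈ = b∈ ; i∈ = i∈ ; j∈ = j∈
                       ; i<j = ∈-pairs-related (sorted-σReps σ b) ij∈ })

  private
    formula : ∀ f {T σ} (vx : Valid (emb T σ)) → emb T σ ⊑ y → rank (emb T σ) ≤ f → Dec (emb T σ ≡ y) →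
              2 ^ excess σ * chainCount f (emb T σ) ≡ excess σ ! * weight σ
    formula f vx x⊑y rank≤f (yes refl) =
      trans (cong₂ (λ e c → 2 ^ e * c) excess-π (chainCount-top f)) (sym (cong₂ (λ e w → e ! * w) excess-π weight-π))
    formula zero {T} {σ} vx x⊑y rank≤0 (no x≢y) =
      ⊥-elim (n≮0 (<-≤-trans (rank-covers (emb T σ) vx x⊑y (∈-mergeCovers⁺ {T} (mergePair-below vx x⊑y x≢y))) rank≤0))
    formula (suc f) {T} {σ} vx x⊑y rank≤f (no x≢y) =
      chainCount-formula-step vx x⊑y x≢y f λ p →
        let open MergePair p
            z⋖ = merge-⋖ {T} {σ} vx x⊑y rep-i rep-j i<j i∼j in
        formula f {mergeSubset σ i j T} {merge σ i j} (proj₁ z⋖) (proj₁ (proj₂ (proj₂ z⋖)))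
                (≤-pred (≤-trans (rank-covers (emb T σ) vx x⊑y (∈-mergeCovers⁺ {T} p)) rank≤f)) (_ ≟ᴱ y)

  chainCount-formula : ∀ f {T σ} (vx : Valid (emb T σ)) → emb T σ ⊑ y → rank (emb T σ) ≤ f →
                       2 ^ excess σ * chainCount f (emb T σ) ≡ excess σ ! * weight σ
  chainCount-formula f {T} {σ} vx x⊑y rank≤f = formula f vx x⊑y rank≤f (emb T σ ≟ᴱ y)

  isRep-discrete : ∀ k → IsRep (discrete {n}) k
  isRep-discrete k k′ k′<k k′∼k = Fin.<-irrefl (discrete⁻ k′∼k) k′<k

  σReps-discrete : ∀ b → σReps discrete b ≡ filter (_∼[ π ]? b) (allFin n)
  σReps-discrete b = filter-≐ (σRep? discrete b) (_∼[ π ]? b) (proj₂ , (isRep-discrete _ ,_)) (allFin n)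

  blockCount-discrete : ∀ b → blockCount discrete b ≡ ∣ lookup π b ∣
  blockCount-discrete b =
    trans (cong length (trans (σReps-discrete b) (filter-≐ (_∼[ π ]? b) (b ∼[ π ]?_) (π.∼-sym , π.∼-sym) (allFin n))))
          (length-members (lookup π b))

  sum-blockCount-discrete : sum (map (blockCount discrete) πReps) ≡ n
  sum-blockCount-discrete =
    begin
      sum (map (blockCount discrete) πReps)
    ≡⟨ sum-map-cong {xs = πReps} (All.tabulate λ {b} _ → cong length (σReps-discrete b)) ⟩
      sum (map (λ b → length (filter (_∼[ π ]? b) (allFin n))) πReps)
    ≡⟨ sum-count-swap _∼[ π ]?_ (allFin n) πReps ⟩
      sum (map (λ k → length (filter (k ∼[ π ]?_) πReps)) (allFin n))
    ≡⟨ sum-map-const {xs = allFin n} (All.tabulate λ {k} _ → one-block k) ⟩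
      length (allFin n) * 1
    ≡⟨ trans (*-identityʳ _) (length-tabulate id) ⟩
      n
    ∎
    where
    open ≡-Reasoning
    one-block : ∀ k → length (filter (k ∼[ π ]?_) πReps) ≡ 1
    one-block k with πR.rep k
    ... | r , r∼k , rep-r = length-filter-≡1 (k ∼[ π ]?_) unique-πReps (∈-πReps⁺ rep-r) (π.∼-sym r∼k)
          λ a∈ k∼a → πR.rep-unique (∈-πReps⁻ a∈) rep-r (π.∼-trans (π.∼-sym k∼a) (π.∼-sym r∼k))

  excess-discrete : excess discrete ≡ n ∸ length πReps
  excess-discrete =
    trans (sym (m+n∸n≡m (excess discrete) (length πReps)))
          (cong (_∸ length πReps) (trans (sum-map-pred (blockCount discrete) {πReps} (All.tabulate λ {b} _ → nonempty b))
                                         sum-blockCount-discrete))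
    where
    nonempty : ∀ b → 1 ≤ blockCount discrete b
    nonempty b = 1≤length (∈-σReps⁺ discrete b (isRep-discrete b) (π.∼-refl b))

  weight-discrete : weight discrete ≡ product (map (λ b → ∣ lookup π b ∣ !) πReps)
  weight-discrete = product-map-cong {xs = πReps} (All.tabulate λ {b} _ → cong _! (blockCount-discrete b))

  bottom-formula : 2 ^ excess discrete * chainCount (rank bot) bot ≡ ∣ S ∣ * (excess discrete ! * weight discrete)
  bottom-formula =
    begin
      2 ^ e * chainCount (suc (gaps (discrete {n}))) bot
    ≡⟨ cong (2 ^ e *_) (chainCount-step (gaps (discrete {n})) bot (λ ())) ⟩
      2 ^ e * sum (map (chainCount (gaps (discrete {n}))) (map atom (members S)))
    ≡⟨ cong (λ s → 2 ^ e * sum s) (map-∘ (members S)) ⟨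
      2 ^ e * sum (map (chainCount (gaps (discrete {n})) ∘ atom) (members S))
    ≡⟨ *-sum-map (chainCount (gaps (discrete {n})) ∘ atom) (2 ^ e) (members S) ⟩
      sum (map (λ i → 2 ^ e * chainCount (gaps (discrete {n})) (atom i)) (members S))
    ≡⟨ sum-map-const (All.tabulate per-atom) ⟩
      length (members S) * (e ! * weight discrete)
    ≡⟨ cong (_* (e ! * weight discrete)) (length-members S) ⟩
      ∣ S ∣ * (e ! * weight discrete)
    ∎
    where
    open ≡-Reasoning
    e : ℕ
    e = excess discrete
    per-atom : ∀ {i} → i ∈ members S → 2 ^ e * chainCount (gaps (discrete {n})) (atom i) ≡ e ! * weight discrete
    per-atom {i} i∈ = chainCount-formula (gaps (discrete {n})) (atom-valid i) (proj₁ (proj₂ (proj₂ (atom-⋖ i∈S)))) ≤-refl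
      where
      i∈S : i ∈ₛ S
      i∈S = proj₂ (∈-filter⁻ (λ k → lookup S k ≟ᵇ true) {xs = allFin n} i∈)

-- The three counts

full : ∀ n → Rel n
full n = replicate n (replicate n true)

full-∼ : ∀ {n} (k l : Fin n) → k ∼[ full n ] l
full-∼ {n} k l = trans (cong (λ r → lookup r l) (Vec.lookup-replicate k (replicate n true))) (Vec.lookup-replicate l true)

full-isPartition : ∀ n → IsPartition (full n)
full-isPartition n = (λ k → full-∼ k k) , (λ k l _ → full-∼ l k) , λ k _ m _ _ → full-∼ k m

top-valid : ∀ n → Valid (topElem (suc n))
top-valid n = full-isPartition (suc n) , zero , refl

⊑-top : ∀ {n} (T : Subset n) R → emb T R ⊑ topElem n
⊑-top T R = Sub.⊆⊤ , λ k l _ → full-∼ k l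

full-blocks : ∀ n B → (B ∈ replicate (suc n) true ∷ []) ⇔ IsBlock (full (suc n)) B
full-blocks n B = mk⇔ (λ { (here refl) → zero , refl })
                      (λ { (i , refl) → here (Vec.lookup-replicate i (replicate (suc n) true)) })

length-blockReps-full : ∀ n → length (blockReps (full (suc n))) ≡ 1
length-blockReps-full n = length-blockReps (full (suc n)) (full-isPartition (suc n)) ([] ∷ []) (full-blocks n)

/2^-exact : ∀ e {X N} → 2 ^ e * N ≡ X → X /2^ e ≡ N
/2^-exact e {N = N} refl = trans (cong (_/2^ e) (*-comm (2 ^ e) N)) (m*n/n≡m N (2 ^ e) {{m^n≢0 2 e}})

module BelowEmbedded {n} (S : Subset n) (R : Rel n) (vx : Valid (emb S R)) {bs : List (Subset n)}
                     (u : Unique (S ∷ bs)) (blocks : ∀ B → (B ∈ S ∷ bs) ⇔ IsBlock R B) where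

  open ChainCounting S R vx

  e : ℕ
  e = n ∸ suc (length bs)

  bottom-count : 2 ^ e * chainCount (rank bot) bot ≡ ∣ S ∣ * (e ! * (∣ S ∣ ! * product (map (λ B → ∣ B ∣ !) bs)))
  bottom-count =
    begin
      2 ^ e * chainCount (rank bot) bot
    ≡⟨ cong (λ d → 2 ^ d * chainCount (rank bot) bot) excess≡ ⟨
      2 ^ excess discrete * chainCount (rank bot) bot
    ≡⟨ bottom-formula ⟩
      ∣ S ∣ * (excess discrete ! * weight discrete)
    ≡⟨ cong₂ (λ d w → ∣ S ∣ * (d ! * w)) excess≡ weight≡ ⟩
      ∣ S ∣ * (e ! * (∣ S ∣ ! * product (map (λ B → ∣ B ∣ !) bs)))
    ∎
    where
    open ≡-Reasoning
    excess≡ : excess discrete ≡ e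
    excess≡ = trans excess-discrete (cong (n ∸_) (length-blockReps R (proj₁ vx) u blocks))
    weight≡ : weight discrete ≡ ∣ S ∣ ! * product (map (λ B → ∣ B ∣ !) bs)
    weight≡ = trans weight-discrete (product-blockReps R (proj₁ vx) u blocks (λ B → ∣ B ∣ !))

module BelowTop {n} (S : Subset (suc n)) (R : Rel (suc n)) (vx : Valid (emb S R)) {bs : List (Subset (suc n))}
                (u : Unique (S ∷ bs)) (blocks : ∀ B → (B ∈ S ∷ bs) ⇔ IsBlock R B) where

  open ChainCounting (replicate (suc n) true) (full (suc n)) (top-valid n)

  private
    k : ℕ
    k = suc (length bs)

  blockCount-full : ∀ b → blockCount R b ≡ k
  blockCount-full b =
    trans (cong length (filter-≐ (σRep? R b) (isRep? R) (proj₁ , λ {k} rep-k → rep-k , full-∼ k b) (allFin (suc n))))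
          (length-blockReps R (proj₁ vx) u blocks)

  top-count : 2 ^ length bs * chainCount (rank (emb S R)) (emb S R) ≡ length bs ! * (k ! * 1)
  top-count =
    begin
      2 ^ length bs * N
    ≡⟨ cong (λ d → 2 ^ d * N) excess≡ ⟨
      2 ^ excess R * N
    ≡⟨ chainCount-formula (rank (emb S R)) vx (⊑-top S R) ≤-refl ⟩
      excess R ! * weight R
    ≡⟨ cong₂ (λ d w → d ! * w) excess≡ weight≡ ⟩
      length bs ! * (k ! * 1)
    ∎
    where
    open ≡-Reasoning
    N : ℕ
    N = chainCount (rank (emb S R)) (emb S R)
    excess≡ : excess R ≡ length bs
    excess≡ = trans (sum-map-const {xs = πReps} (All.tabulate λ {b} _ → cong (_∸ 1) (blockCount-full b)))
                    (trans (cong (_* length bs) (length-blockReps-full n)) (+-identityʳ (length bs)))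
    weight≡ : weight R ≡ k ! * 1
    weight≡ = trans (product-map-cong {xs = πReps} (All.tabulate λ {b} _ → cong _! (blockCount-full b)))
                    (product-blockReps (full (suc n)) (full-isPartition (suc n)) ([] ∷ []) (full-blocks n) (λ _ → k !))

module WholeLattice (m : ℕ) where

  open ChainCounting (replicate (suc m) true) (full (suc m)) (top-valid m)

  whole-count : 2 ^ m * chainCount (rank bot) bot ≡ suc m * (m ! * (suc m ! * 1))
  whole-count =
    begin
      2 ^ m * N
    ≡⟨ cong (λ d → 2 ^ d * N) excess≡ ⟨
      2 ^ excess discrete * N
    ≡⟨ bottom-formula ⟩
      ∣ replicate (suc m) true ∣ * (excess discrete ! * weight discrete)
    ≡⟨ cong₂ (λ s (dw : ℕ × ℕ) → s * (proj₁ dw ! * proj₂ dw)) (Sub.∣⊤∣≡n (suc m)) (cong₂ _,_ excess≡ weight≡) ⟩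
      suc m * (m ! * (suc m ! * 1))
    ∎
    where
    open ≡-Reasoning
    N : ℕ
    N = chainCount (rank bot) bot
    excess≡ : excess discrete ≡ m
    excess≡ = trans excess-discrete (cong (suc m ∸_) (length-blockReps-full m))
    weight≡ : weight discrete ≡ suc m ! * 1
    weight≡ = trans weight-discrete
      (trans (product-blockReps (full (suc m)) (full-isPartition (suc m)) ([] ∷ []) (full-blocks m) (λ B → ∣ B ∣ !))
             (cong (λ s → s ! * 1) (Sub.∣⊤∣≡n (suc m))))

proposition2 : (n : ℕ) → 2 < n → (S : Subset n) (R : Rel n) → Valid (emb S R) →
    (bs : List (Subset n)) → Unique (S ∷ bs) →
    (∀ B → (B ∈ S ∷ bs) ⇔ IsBlock R B) →
    NumMaxChains bot (emb S R)
      ((∣ S ∣ * ((n ∸ suc (length bs)) !) * (∣ S ∣ !) * product (map (λ B → ∣ B ∣ !) bs))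
        /2^ (n ∸ suc (length bs)))
    × Σ ℕ (λ c → NumMaxChains bot (topElem (suc (length bs))) c
        × NumMaxChains (emb S R) (topElem n) (c / suc (length bs))
        × NumMaxChains (emb S R) (topElem n)
            (((suc (length bs)) ! * ((length bs) !)) /2^ (length bs)))
proposition2 (suc n′) _ S R vx bs u blocks =
  subst (NumMaxChains bot (emb S R)) (sym (/2^-exact e (trans bottom-count (reassociate ∣ S ∣ (e !) (∣ S ∣ !) _))))
        (Below.numMaxChains (Below.rank bot) bot tt tt ≤-refl) ,
  c , Whole.numMaxChains (Whole.rank bot) bot tt tt ≤-refl ,
  subst (NumMaxChains (emb S R) (topElem (suc n′))) (sym c/k≡) top-chains ,
  subst (NumMaxChains (emb S R) (topElem (suc n′))) (sym (/2^-exact lb (trans top-count (commute (lb !) (k !)))))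
        top-chains
  where
  lb k e : ℕ
  lb = length bs
  k  = suc lb
  e  = suc n′ ∸ k
  module Below = ChainCounting S R vx
  module Top   = ChainCounting (replicate (suc n′) true) (full (suc n′)) (top-valid n′)
  module Whole = ChainCounting (replicate k true) (full k) (top-valid lb)
  open BelowEmbedded S R vx u blocks using (bottom-count)
  open BelowTop S R vx u blocks using (top-count)
  open WholeLattice lb using (whole-count)
  c N : ℕ
  c = Whole.chainCount (Whole.rank bot) bot
  N = Top.chainCount (Top.rank (emb S R)) (emb S R)
  top-chains : NumMaxChains (emb S R) (topElem (suc n′)) N
  top-chains = Top.numMaxChains (Top.rank (emb S R)) (emb S R) vx (⊑-top S R) ≤-refl
  reassociate : ∀ s f a b → s * (f * (a * b)) ≡ s * f * a * b
  reassociate = solve-∀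
  commute : ∀ a b → a * (b * 1) ≡ b * a
  commute = solve-∀
  rotate : ∀ a b c → a * (b * c) ≡ b * (c * a)
  rotate = solve-∀
  c≡N*k : c ≡ N * k
  c≡N*k = *-cancelˡ-≡ c (N * k) (2 ^ lb) {{m^n≢0 2 lb}}
            (trans whole-count (trans (cong (k *_) (sym top-count)) (rotate k (2 ^ lb) N)))
  c/k≡ : c / k ≡ N
  c/k≡ = trans (cong (_/ k) c≡N*k) (m*n/n≡m N k)
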